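{- Let $q$ be a prime, $\ell\ge 1$, $\mathcal G=(V,\le,E)$ an undirected, linearly ordered finite graph with $\mathrm{con}(\mathcal G)>\ell+2$, $\vec d\in\{0,\dots,q-1\}^V$, and $\mathfrak A=\mathrm{CFI}_q(\mathcal G,\vec d)$ with universe $A$. Let $\lambda\le\ell$ and $\bar a,\bar b\in A^\lambda$. Then $(\mathfrak A,\bar a)\equiv^C_{\ell+2}(\mathfrak A,\bar b)$ if and only if there exists $\pi\in\mathrm{Aut}(\mathfrak A)$ with $\pi(\bar a)=\bar b$.
   Context: $\mathrm{con}(\mathcal G)$, the connectivity, is the maximal $k\ge1$ such that $\mathcal G$ has more than $k$ vertices and remains connected after removing any set of at most $k$ vertices. $(\mathfrak A,\bar a)\equiv^C_{k}(\mathfrak A,\bar b)$ means the tuples satisfy the same formulas of $C^{k}_{\infty\omega}$ (infinitary logic with counting quantifiers, at most $k$ variables). $E$ is regarded as a set of directed edges ($(v,w)$ and $(w,v)$ for each undirected edge, $e^{ -1}$ the reverse of $e$); $E(v)$ is the set of directed edges starting at $v$; arithmetic is mod $q$. $\mathrm{CFI}_q(\mathcal G,\vec d)$ is the structure with signature $\{\preceq,C,I,R\}$ whose universe consists of edge nodes $e_0,\dots,e_{q-1}$ for each directed edge $e$, and for each $v\in V$ the equation class $\hat v^{\vec d(v)}$ of all $\rho:E(v)\to\{0,\dots,q-1\}$ with $\sum_{e\in E(v)}\rho(e)=\vec d(v)$; $\preceq$ is the preorder ordering edge classes by the linear order on $E$ induced by $\le$, equation classes by $\le$ on $V$, edge nodes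 before equation nodes (same class = equivalent); $C=\{(e_i,e_{i+1})\}$; $I=\{(e_x,f_y): f=e^{ -1},\ x+y=0\}$; $R=\{(\rho,e_{\rho(e)}): \rho\in\hat v^{\vec d(v)},\ e\in E(v)\}$. -}

module Defs where

open import Level using (Level) renaming (zero to lzero; suc to lsuc)
open import Data.Nat using (ℕ; zero; suc; _+_; _<_; _≤_; _%_; _≡ᵇ_; NonZero)
open import Data.Fin using (Fin; toℕ; fromℕ<) renaming (_≟_ to _≟ᶠ_)
open import Data.Fin using () renaming (_<_ to _<ᶠ_; _≤_ to _≤ᶠ_)
open import Data.Fin.Subset using (Subset; _∈_; _∉_; ∣_∣)
open import Data.Bool using (Bool; true; false; T; _∧_; _∨_)
open import Data.Vec using (Vec; lookup)
import Data.Vec as Vec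
import Data.List as List
open import Data.Product using (Σ; _×_; _,_; ∃)
open import Data.Sum using (_⊎_)
open import Relation.Nullary using (¬_; yes; no)
open import Relation.Binary.PropositionalEquality using (_≡_; _≢_)
open import Function.Definitions using (Injective)
open import Function.Bundles using (_↔_; _⇔_; Inverse)

-- Graphs: a linearly ordered finite graph is given on vertex set Fin n,
-- with the linear order being the usual order of Fin n.

record Graph (n : ℕ) : Set where
  field
    adj    : Fin n → Fin n → Bool
    sym    : ∀ v w → adj v w ≡ adj w v
    irrefl : ∀ v → adj v v ≡ false
open Graph public

data PathAvoiding {n : ℕ} (G : Graph n) (S : Subset n) : Fin n → Fin n → Set where
  here : ∀ {u} → PathAvoiding G S u u
  step : ∀ {u v w} → T (adj G u v) → v ∉ S → PathAvoiding G S v w → PathAvoiding G S u w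

KConnected : {n : ℕ} → Graph n → ℕ → Set
KConnected {n} G k =
  k < n × (∀ (S : Subset n) → ∣ S ∣ ≤ k →
             ∀ u w → u ∉ S → w ∉ S → PathAvoiding G S u w)

-- con(G) > m, with con(G) the maximal k ≥ 1 for which G is k-connected.
ConGreaterThan : {n : ℕ} → Graph n → ℕ → Set
ConGreaterThan G m = Σ ℕ λ k → 1 ≤ k × m < k × KConnected G k

data Sym : Set where
  ⪯ˢ Cˢ Iˢ Rˢ : Sym

record Structure : Set₁ where
  field
    Carrier : Set
    Rel     : Sym → Carrier → Carrier → Set
open Structure public

-- Infinitary logic with counting, k variables: C^k_{∞ω}.

data Formula (k : ℕ) : Set₁ where
  eqF   : Fin k → Fin k → Formula k
  relF  : Sym → Fin k → Fin k → Formula k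
  negF  : Formula k → Formula k
  conjF : (I : Set) → (I → Formula k) → Formula k
  cntF  : ℕ → Fin k → Formula k → Formula k

data Free {k : ℕ} (x : Fin k) : Formula k → Set₁ where
  eqˡ  : ∀ {y} → Free x (eqF x y)
  eqʳ  : ∀ {y} → Free x (eqF y x)
  relˡ : ∀ {r y} → Free x (relF r x y)
  relʳ : ∀ {r y} → Free x (relF r y x)
  neg  : ∀ {φ} → Free x φ → Free x (negF φ)
  conj : ∀ {I φ} (i : I) → Free x (φ i) → Free x (conjF I φ)
  cnt  : ∀ {m y φ} → x ≢ y → Free x φ → Free x (cntF m y φ)

update : {k : ℕ} {A : Set} → (Fin k → A) → Fin k → A → (Fin k → A)
update α x a y with x ≟ᶠ y
... | yes _ = a
... | no _  = α y

Sat : {k : ℕ} (𝔄 : Structure) → (Fin k → Carrier 𝔄) → Formula k → Set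
Sat 𝔄 α (eqF x y)    = α x ≡ α y
Sat 𝔄 α (relF r x y) = Rel 𝔄 r (α x) (α y)
Sat 𝔄 α (negF φ)     = ¬ Sat 𝔄 α φ
Sat 𝔄 α (conjF I φ)  = (i : I) → Sat 𝔄 α (φ i)
Sat 𝔄 α (cntF m x φ) =
  Σ (Fin m → Carrier 𝔄) λ f → Injective _≡_ _≡_ f × (∀ j → Sat 𝔄 (update α x (f j)) φ)

-- (𝔄, ā) ≡^C_k (𝔄, b̄) for m-tuples ā, b̄ (variables x₀..x_{m-1} are
-- the first m of the k variables).
TupleEquiv : (k : ℕ) (𝔄 : Structure) (m : ℕ) → (Fin m → Carrier 𝔄) → (Fin m → Carrier 𝔄) → Set₁
TupleEquiv k 𝔄 m a b =
  ∀ (φ : Formula k) → (∀ x → Free x φ → toℕ x < m) →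
  ∀ (α β : Fin k → Carrier 𝔄) →
  (∀ x (p : toℕ x < m) → α x ≡ a (fromℕ< p)) →
  (∀ x (p : toℕ x < m) → β x ≡ b (fromℕ< p)) →
  (Sat 𝔄 α φ → Sat 𝔄 β φ) × (Sat 𝔄 β φ → Sat 𝔄 α φ)

IsAutomorphism : (𝔄 : Structure) → (Carrier 𝔄 ↔ Carrier 𝔄) → Set
IsAutomorphism 𝔄 π =
  ∀ r x y → Rel 𝔄 r x y ⇔ Rel 𝔄 r (Inverse.to π x) (Inverse.to π y)

module _ (q : ℕ) .{{_ : NonZero q}} {n : ℕ} (G : Graph n) (d : Fin n → Fin q) where

  -- ρ : E(v) → Fin q is represented by a vector indexed by all vertices w,
  -- the entry at w being ρ((v,w)); entries at non-neighbours are 0.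
  allB : {A : Set} → (A → Bool) → List.List A → Bool
  allB f List.[] = true
  allB f (x List.∷ xs) = f x ∧ allB f xs

  validEq : Fin n → Vec (Fin q) n → Bool
  validEq v ρ =
    allB (λ w → adj G v w ∨ (toℕ (lookup ρ w) ≡ᵇ 0)) (List.allFin n)
    ∧ ((Vec.sum (Vec.map toℕ ρ) % q) ≡ᵇ toℕ (d v))

  data CFINode : Set where
    edgeNode : (v w : Fin n) → T (adj G v w) → Fin q → CFINode
    eqNode   : (v : Fin n) (ρ : Vec (Fin q) n) → T (validEq v ρ) → CFINode

  _≤E_ : (Fin n × Fin n) → (Fin n × Fin n) → Set
  (v , w) ≤E (v' , w') = v <ᶠ v' ⊎ (v ≡ v' × w ≤ᶠ w')

  data CFIRel : Sym → CFINode → CFINode → Set where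
    pre-ee : ∀ {v w p i v' w' p' j} → (v , w) ≤E (v' , w') →
             CFIRel ⪯ˢ (edgeNode v w p i) (edgeNode v' w' p' j)
    pre-eq : ∀ {v w p i u ρ r} → CFIRel ⪯ˢ (edgeNode v w p i) (eqNode u ρ r)
    pre-qq : ∀ {u ρ r u' ρ' r'} → u ≤ᶠ u' → CFIRel ⪯ˢ (eqNode u ρ r) (eqNode u' ρ' r')
    cyc    : ∀ {v w p i j} → toℕ j ≡ (toℕ i + 1) % q →
             CFIRel Cˢ (edgeNode v w p i) (edgeNode v w p j)
    inv    : ∀ {v w p i p' j} → (toℕ i + toℕ j) % q ≡ 0 →
             CFIRel Iˢ (edgeNode v w p i) (edgeNode w v p' j)
    rel    : ∀ {v ρ r w p} →
             CFIRel Rˢ (eqNode v ρ r) (edgeNode v w p (lookup ρ w))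

  CFI : Structure
  CFI = record { Carrier = CFINode ; Rel = CFIRel }

module Submission where

-- Write 𝔄 = CFI_q(G, d).  The easy direction holds in any
-- structure: automorphisms preserve satisfaction of every formula.  For the
-- hard direction, every flow (antisymmetric integer edge weights supported on
-- the edges of G with net outflow ≡ 0 mod q at each vertex) induces an
-- automorphism of 𝔄 shifting edge and equation nodes.  Given ā ≡^C_{ℓ+2} b̄,
-- we use counting formulas with two variables beyond the tuple to show that
--   (1) aᵢ and bᵢ lie in the same class, so mapping aᵢ to bᵢ imposes a linear
--       constraint (an edge value, or a whole row at a vertex) on the flow;
--   (2) any two of these constraints agree modulo q on every common edge.
-- Finally (3) consistent constraints, at most ℓ of them, extend to a flow: we
-- take the prescribed values and move the resulting excess to a root along
-- detours that avoid all constrained vertices, which exist as G stays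
-- connected after removing any ℓ + 2 vertices.

open import Data.Nat as ℕ using (ℕ; zero; suc; NonZero; _<_; _≤_; z≤n; s≤s)
import Data.Nat.Properties as ℕP
open import Data.Nat.DivMod as ℕD using ()
open import Data.Nat.Primality using (Prime)
open import Data.Integer using (ℤ; +_; -_; _+_; _-_; _*_; -[1+_])
import Data.Integer.Properties as ℤP
open import Data.Integer.DivMod using (_%ℕ_; _/ℕ_; n%ℕd<d; a≡a%ℕn+[a/ℕn]*n)
open import Data.Integer.Tactic.RingSolver using (solve-∀)
open import Algebra.Properties.Semiring.Sum ℤP.+-*-semiring
  using (sum-cong-≗; ∑-distrib-+; ∑-comm; sum-replicate-zero; *-distribˡ-sum) renaming (sum to ∑)
import Data.Fin as F
open import Data.Fin using (Fin; toℕ; fromℕ<) renaming (_≟_ to _≟ᶠ_; _<_ to _<ᶠ_)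
import Data.Fin.Properties as FP
open import Data.Fin.Subset using (Subset; _∈_; _∉_; ∣_∣; _∪_; ⁅_⁆) renaming (⊥ to ∅)
import Data.Fin.Subset.Properties as SubsetP
open SubsetP using (_∈?_)
open import Data.Product using (Σ; _,_; _×_; proj₁; proj₂)
open import Data.Sum using (_⊎_; inj₁; inj₂)
open import Data.Bool using (Bool; true; false; T; _∨_; if_then_else_)
import Data.Bool.Properties as BP
open import Data.Unit using (tt)
open import Data.Empty using (⊥; ⊥-elim)
open import Data.Maybe using (Maybe; just; nothing)
open import Data.Vec as Vec using (Vec; lookup; tabulate; []; _∷_; here; there)
import Data.Vec.Properties as VP
open import Data.List as List using (List; []; _∷_; length; filter; cartesianProduct; allFin; map)
open import Data.List.Membership.Propositional using () renaming (_∈_ to _∈ˡ_)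
open import Data.List.Membership.Propositional.Properties
  using (∈-allFin; ∈-cartesianProduct⁺; ∈-filter⁺; ∈-filter⁻; ∈-lookup)
import Data.List.Membership.Setoid.Properties as SetoidMembership
open import Data.List.Relation.Unary.Any using (here; there; index)
import Data.List.Relation.Unary.All as All
open import Data.List.Relation.Unary.AllPairs using (_∷_)
open import Data.List.Relation.Unary.Unique.Propositional using (Unique)
import Data.List.Relation.Unary.Unique.Propositional.Properties as UniqueP
open import Relation.Binary using (Setoid; tri<; tri≈; tri>)
import Relation.Binary.Reasoning.Setoid as SetoidReasoning
open import Relation.Binary.PropositionalEquality
open import Relation.Nullary using (yes; no; ¬_; Dec)
open import Relation.Nullary.Decidable using (T?)
open import Function.Definitions using (Injective)
open import Function.Bundles using (_↔_; Inverse; Equivalence; mk↔ₛ′; mk⇔)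
open import Defs hiding (sym)

-- Congruence modulo q on ℤ and reduction of integers to residues in Fin q.
-- The CFI gadgets live in ℤ/qℤ; we compute in ℤ and only compare modulo q.
module Congruence (q : ℕ) .{{_ : NonZero q}} where

  infix 4 _≈_
  record _≈_ (x y : ℤ) : Set where
    constructor by-quotient
    field
      quotient : ℤ
      difference : x - y ≡ quotient * + q

  ≈-refl : ∀ {x} → x ≈ x
  ≈-refl {x} = by-quotient (+ 0) (trans (ℤP.+-inverseʳ x) (sym (ℤP.*-zeroˡ (+ q))))

  ≈-reflexive : ∀ {x y} → x ≡ y → x ≈ y
  ≈-reflexive refl = ≈-refl

  private
    sub-swap : ∀ x y → y - x ≡ - (x - y)
    sub-swap = solve-∀
    sub-split : ∀ x y z → x - z ≡ (x - y) + (y - z)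
    sub-split = solve-∀
    sub-+ : ∀ a b c d → (a + c) - (b + d) ≡ (a - b) + (c - d)
    sub-+ = solve-∀
    sub-neg : ∀ a b → - a - - b ≡ - (a - b)
    sub-neg = solve-∀
    sub-* : ∀ c a b → c * a - c * b ≡ c * (a - b)
    sub-* = solve-∀

  ≈-sym : ∀ {x y} → x ≈ y → y ≈ x
  ≈-sym {x} {y} (by-quotient k e) =
    by-quotient (- k) (trans (sub-swap x y) (trans (cong -_ e) (ℤP.neg-distribˡ-* k (+ q))))

  ≈-trans : ∀ {x y z} → x ≈ y → y ≈ z → x ≈ z
  ≈-trans {x} {y} {z} (by-quotient k e) (by-quotient k' e') = by-quotient (k + k')
    (trans (sub-split x y z) (trans (cong₂ _+_ e e') (sym (ℤP.*-distribʳ-+ (+ q) k k'))))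

  ≈-setoid : Setoid _ _
  ≈-setoid = record
    { Carrier = ℤ ; _≈_ = _≈_
    ; isEquivalence = record { refl = ≈-refl ; sym = ≈-sym ; trans = ≈-trans } }

  module ≈-Reasoning = SetoidReasoning ≈-setoid

  ≈-+ : ∀ {a b c d} → a ≈ b → c ≈ d → a + c ≈ b + d
  ≈-+ {a} {b} {c} {d} (by-quotient k e) (by-quotient k' e') = by-quotient (k + k')
    (trans (sub-+ a b c d) (trans (cong₂ _+_ e e') (sym (ℤP.*-distribʳ-+ (+ q) k k'))))

  ≈-neg : ∀ {a b} → a ≈ b → - a ≈ - b
  ≈-neg {a} {b} (by-quotient k e) =
    by-quotient (- k) (trans (sub-neg a b) (trans (cong -_ e) (ℤP.neg-distribˡ-* k (+ q))))

  ≈-*ˡ : ∀ c {a b} → a ≈ b → c * a ≈ c * b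
  ≈-*ˡ c {a} {b} (by-quotient k e) = by-quotient (c * k)
    (trans (sub-* c a b) (trans (cong (c *_) e) (sym (ℤP.*-assoc c k (+ q)))))

  residue-unique : ∀ {r r'} → r ℕ.< q → r' ℕ.< q → + r ≈ + r' → r ≡ r'
  residue-unique {r} {r'} r<q r'<q (by-quotient k e) = from-quotient k (shift (+ r) (+ r') (k * + q) e)
    where
    shift : ∀ a b c → a - b ≡ c → a ≡ b + c
    shift a b c eq = trans (sym (cancel a b)) (cong (λ t → b + t) eq)
      where cancel : ∀ a b → b + (a - b) ≡ a
            cancel = solve-∀
    too-big : ∀ {s t} j → s ℕ.< q → s ≡ t ℕ.+ (q ℕ.+ j ℕ.* q) → ⊥
    too-big {s} {t} j s<q eq = ℕP.<-irrefl refl (ℕP.<-≤-trans s<q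
      (subst (q ℕ.≤_) (sym eq) (ℕP.≤-trans (ℕP.m≤m+n q (j ℕ.* q)) (ℕP.m≤n+m _ t))))
    from-quotient : ∀ k → + r ≡ + r' + k * + q → r ≡ r'
    from-quotient (+ zero) eq = ℤP.+-injective
      (trans eq (trans (cong (λ t → + r' + t) (ℤP.*-zeroˡ (+ q))) (ℤP.+-identityʳ (+ r'))))
    from-quotient (+ suc j) eq = ⊥-elim (too-big {t = r'} j r<q (ℤP.+-injective
      (trans eq (trans (cong (λ t → + r' + t) (sym (ℤP.pos-* (suc j) q))) (sym (ℤP.pos-+ r' _))))))
    from-quotient -[1+ j ] eq = ⊥-elim (too-big {t = r} j r'<q (ℤP.+-injective
      (trans (swap (+ r) (+ r') (+ suc j * + q) eq')
        (trans (cong (λ t → + r + t) (sym (ℤP.pos-* (suc j) q))) (sym (ℤP.pos-+ r _))))))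
      where
      eq' : + r ≡ + r' + (- (+ suc j * + q))
      eq' = trans eq (cong (λ t → + r' + t) (sym (ℤP.neg-distribˡ-* (+ suc j) (+ q))))
      swap : ∀ a b c → a ≡ b + (- c) → b ≡ a + c
      swap a b c eq = trans (move b c) (cong (_+ c) (sym eq))
        where move : ∀ b c → b ≡ (b + (- c)) + c
              move = solve-∀

  reduce : ℤ → Fin q
  reduce x = fromℕ< (n%ℕd<d x q)

  reduce-≈ : ∀ x → + toℕ (reduce x) ≈ x
  reduce-≈ x = by-quotient (- (x /ℕ q)) (begin
      + toℕ (reduce x) - x                  ≡⟨ cong (λ t → + t - x) (FP.toℕ-fromℕ< (n%ℕd<d x q)) ⟩
      + (x %ℕ q) - x                        ≡⟨ cong (λ t → + (x %ℕ q) - t) (a≡a%ℕn+[a/ℕn]*n x q) ⟩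
      + (x %ℕ q) - (+ (x %ℕ q) + (x /ℕ q) * + q) ≡⟨ cancel (+ (x %ℕ q)) (x /ℕ q) (+ q) ⟩
      - (x /ℕ q) * + q                      ∎)
    where
    open ≡-Reasoning
    cancel : ∀ a b c → a - (a + b * c) ≡ - b * c
    cancel = solve-∀

  reduce-unique : ∀ x (f : Fin q) → + toℕ f ≈ x → reduce x ≡ f
  reduce-unique x f e = FP.toℕ-injective
    (residue-unique (FP.toℕ<n (reduce x)) (FP.toℕ<n f) (≈-trans (reduce-≈ x) (≈-sym e)))

  %-≈ : ∀ x → + (x ℕ.% q) ≈ + x
  %-≈ x = ≈-sym (by-quotient (+ (x ℕ./ q)) (begin
      + x - + (x ℕ.% q)                           ≡⟨ cong (λ t → + t - + (x ℕ.% q)) (ℕD.m≡m%n+[m/n]*n x q) ⟩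
      + (x ℕ.% q ℕ.+ x ℕ./ q ℕ.* q) - + (x ℕ.% q) ≡⟨ cong (_- + (x ℕ.% q)) (ℤP.pos-+ (x ℕ.% q) _) ⟩
      + (x ℕ.% q) + + (x ℕ./ q ℕ.* q) - + (x ℕ.% q) ≡⟨ cong (λ t → + (x ℕ.% q) + t - + (x ℕ.% q)) (ℤP.pos-* (x ℕ./ q) q) ⟩
      + (x ℕ.% q) + + (x ℕ./ q) * + q - + (x ℕ.% q) ≡⟨ cancel (+ (x ℕ.% q)) (+ (x ℕ./ q) * + q) ⟩
      + (x ℕ./ q) * + q                           ∎))
    where
    open ≡-Reasoning
    cancel : ∀ a b → a + b - a ≡ b
    cancel = solve-∀

  %-from-≈ : ∀ x r → r ℕ.< q → + x ≈ + r → x ℕ.% q ≡ r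
  %-from-≈ x r r<q e = residue-unique (ℕD.m%n<n x q) r<q (≈-trans (%-≈ x) e)

  %-to-≈ : ∀ x r → x ℕ.% q ≡ r → + x ≈ + r
  %-to-≈ x r e = ≈-trans (≈-sym (%-≈ x)) (≈-reflexive (cong +_ e))

∑-zero : ∀ {n} (f : Fin n → ℤ) → (∀ i → f i ≡ + 0) → ∑ f ≡ + 0
∑-zero {n} f f≡0 = trans (sum-cong-≗ f≡0) (sum-replicate-zero n)

∑-neg : ∀ {n} (f : Fin n → ℤ) → ∑ (λ i → - f i) ≡ - ∑ f
∑-neg {zero} f = refl
∑-neg {suc n} f = trans (cong (λ t → - f F.zero + t) (∑-neg (λ i → f (F.suc i)))) (sym (ℤP.neg-distrib-+ (f F.zero) _))

-- The sum of an antisymmetric matrix vanishes: it equals its own negation.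
∑∑-antisym : ∀ {n} (f : Fin n → Fin n → ℤ) → (∀ x y → f y x ≡ - f x y) → ∑ (λ x → ∑ (f x)) ≡ + 0
∑∑-antisym f antisym = self-neg _ (begin
    ∑ (λ x → ∑ (f x))          ≡⟨ ∑-comm f ⟩
    ∑ (λ y → ∑ (λ x → f x y))  ≡⟨ sum-cong-≗ (λ y → trans (sum-cong-≗ (λ x → antisym y x)) (∑-neg (f y))) ⟩
    ∑ (λ y → - ∑ (f y))        ≡⟨ ∑-neg (λ y → ∑ (f y)) ⟩
    - ∑ (λ x → ∑ (f x))        ∎)
  where
  open ≡-Reasoning
  self-neg : ∀ z → z ≡ - z → z ≡ + 0
  self-neg (+ zero) _ = refl
  self-neg (+ suc _) ()
  self-neg -[1+ _ ] ()

δ : ∀ {n} → Fin n → Fin n → ℤ → ℤ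
δ y w a with y ≟ᶠ w
... | yes _ = a
... | no _ = + 0

δ-same : ∀ {n} (y : Fin n) a → δ y y a ≡ a
δ-same y a with y ≟ᶠ y
... | yes _ = refl
... | no y≢y = ⊥-elim (y≢y refl)

δ-other : ∀ {n} (y w : Fin n) a → ¬ y ≡ w → δ y w a ≡ + 0
δ-other y w a y≢w with y ≟ᶠ w
... | yes y≡w = ⊥-elim (y≢w y≡w)
... | no _ = refl

∑-δ : ∀ {n} (y : Fin n) a → ∑ (λ w → δ y w a) ≡ a
∑-δ {suc n} F.zero a =
  trans (cong₂ _+_ (δ-same {suc n} F.zero a) (∑-zero {n} (λ i → δ F.zero (F.suc i) a) (λ i → δ-other F.zero (F.suc i) a (λ ()))))
        (ℤP.+-identityʳ a)
∑-δ {suc n} (F.suc y) a =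
  trans (cong₂ _+_ (δ-other (F.suc y) F.zero a (λ ())) (trans (sum-cong-≗ δ-suc) (∑-δ y a))) (ℤP.+-identityˡ a)
  where
  δ-suc : ∀ i → δ (F.suc y) (F.suc i) a ≡ δ y i a
  δ-suc i = by-cases (y ≟ᶠ i)
    where
    by-cases : Dec (y ≡ i) → δ (F.suc y) (F.suc i) a ≡ δ y i a
    by-cases (yes refl) = trans (δ-same (F.suc y) a) (sym (δ-same y a))
    by-cases (no y≢i) = trans (δ-other (F.suc y) (F.suc i) a (λ e → y≢i (FP.suc-injective e))) (sym (δ-other y i a y≢i))

vec-sum : ∀ {n} {q} (ρ : Vec (Fin q) n) → + Vec.sum (Vec.map toℕ ρ) ≡ ∑ (λ w → + toℕ (lookup ρ w))
vec-sum [] = refl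
vec-sum (x ∷ ρ) = trans (ℤP.pos-+ (toℕ x) _) (cong (λ t → + toℕ x + t) (vec-sum ρ))

module SumCongruence (q : ℕ) .{{_ : NonZero q}} where
  open Congruence q

  ∑-≈ : ∀ {n} {f g : Fin n → ℤ} → (∀ i → f i ≈ g i) → ∑ f ≈ ∑ g
  ∑-≈ {zero} e = ≈-refl
  ∑-≈ {suc n} e = ≈-+ (e F.zero) (∑-≈ (λ i → e (F.suc i)))

update-same : ∀ {k} {A : Set} (α : Fin k → A) x a → update α x a x ≡ a
update-same α x a with x ≟ᶠ x
... | yes _ = refl
... | no x≢x = ⊥-elim (x≢x refl)

update-other : ∀ {k} {A : Set} (α : Fin k → A) x a y → ¬ x ≡ y → update α x a y ≡ α y
update-other α x a y x≢y with x ≟ᶠ y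
... | yes x≡y = ⊥-elim (x≢y x≡y)
... | no _ = refl

update-agree : ∀ {k} {A : Set} (α β : Fin k → A) y a x → (¬ y ≡ x → α x ≡ β x) → update α y a x ≡ update β y a x
update-agree α β y a x agree with y ≟ᶠ x
... | yes _ = refl
... | no y≢x = agree y≢x

sat-local : ∀ {k} (𝔄 : Structure) (φ : Formula k) (α β : Fin k → Carrier 𝔄) →
  (∀ x → Free x φ → α x ≡ β x) → Sat 𝔄 α φ → Sat 𝔄 β φ
sat-local 𝔄 (eqF x y) α β agree s = trans (sym (agree x eqˡ)) (trans s (agree y eqʳ))
sat-local 𝔄 (relF r x y) α β agree s = subst₂ (Rel 𝔄 r) (agree x relˡ) (agree y relʳ) s
sat-local 𝔄 (negF φ) α β agree s = λ sβ → s (sat-local 𝔄 φ β α (λ x fr → sym (agree x (neg fr))) sβ)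
sat-local 𝔄 (conjF I φ) α β agree s = λ i → sat-local 𝔄 (φ i) α β (λ x fr → agree x (conj i fr)) (s i)
sat-local 𝔄 (cntF m y φ) α β agree (f , f-inj , sat) = f , f-inj , λ j →
  sat-local 𝔄 φ (update α y (f j)) (update β y (f j))
    (λ x fr → update-agree α β y (f j) x (λ y≢x → agree x (cnt (λ x≡y → y≢x (sym x≡y)) fr))) (sat j)

module Invariance (𝔄 : Structure) (π : Carrier 𝔄 ↔ Carrier 𝔄) (aut : IsAutomorphism 𝔄 π) where
  open Inverse π

  to-injective : ∀ {x y} → to x ≡ to y → x ≡ y
  to-injective {x} {y} e = trans (sym (strictlyInverseʳ x)) (trans (cong from e) (strictlyInverseʳ y))

  from-injective : ∀ {x y} → from x ≡ from y → x ≡ y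
  from-injective {x} {y} e = trans (sym (strictlyInverseˡ x)) (trans (cong to e) (strictlyInverseˡ y))

  to-update : ∀ {k} (α : Fin k → Carrier 𝔄) y a x → to (update α y a x) ≡ update (λ z → to (α z)) y (to a) x
  to-update α y a x with y ≟ᶠ x
  ... | yes _ = refl
  ... | no _ = refl

  sat-invariant : ∀ {k} (φ : Formula k) (α : Fin k → Carrier 𝔄) →
    (Sat 𝔄 α φ → Sat 𝔄 (λ z → to (α z)) φ) × (Sat 𝔄 (λ z → to (α z)) φ → Sat 𝔄 α φ)
  sat-invariant (eqF x y) α = cong to , to-injective
  sat-invariant (relF r x y) α = Equivalence.to (aut r (α x) (α y)) , Equivalence.from (aut r (α x) (α y))
  sat-invariant (negF φ) α =
    (λ s s' → s (proj₂ (sat-invariant φ α) s')) , (λ s s' → s (proj₁ (sat-invariant φ α) s'))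
  sat-invariant (conjF I φ) α =
    (λ s i → proj₁ (sat-invariant (φ i) α) (s i)) , (λ s i → proj₂ (sat-invariant (φ i) α) (s i))
  sat-invariant (cntF m y φ) α = forth , back
    where
    forth : Sat 𝔄 α (cntF m y φ) → Sat 𝔄 (λ z → to (α z)) (cntF m y φ)
    forth (f , f-inj , sat) = (λ j → to (f j)) , (λ e → f-inj (to-injective e)) , λ j →
      sat-local 𝔄 φ _ _ (λ x _ → to-update α y (f j) x) (proj₁ (sat-invariant φ (update α y (f j))) (sat j))
    back : Sat 𝔄 (λ z → to (α z)) (cntF m y φ) → Sat 𝔄 α (cntF m y φ)
    back (g , g-inj , sat) = (λ j → from (g j)) , (λ e → g-inj (from-injective e)) , λ j →
      proj₂ (sat-invariant φ (update α y (from (g j))))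
        (sat-local 𝔄 φ _ _ (λ x _ → sym (trans (to-update α y (from (g j)) x)
                                     (cong (λ t → update (λ z → to (α z)) y t x) (strictlyInverseˡ (g j)))))
          (sat j))

  automorphic⇒equivalent : ∀ k m (a b : Fin m → Carrier 𝔄) → (∀ i → to (a i) ≡ b i) → TupleEquiv k 𝔄 m a b
  automorphic⇒equivalent k m a b a↦b φ fv α β α≈a β≈b =
    (λ s → sat-local 𝔄 φ _ β to-α≡β (proj₁ (sat-invariant φ α) s)) ,
    (λ s → proj₂ (sat-invariant φ α) (sat-local 𝔄 φ β _ (λ x fr → sym (to-α≡β x fr)) s))
    where
    to-α≡β : ∀ x → Free x φ → to (α x) ≡ β x
    to-α≡β x fr = trans (cong to (α≈a x (fv x fr))) (trans (a↦b _) (sym (β≈b x (fv x fr))))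

module _ {k : ℕ} where
  existsF : Fin k → Formula k → Formula k
  existsF s φ = cntF 1 s φ

  _∧F_ : Formula k → Formula k → Formula k
  φ ∧F ψ = conjF Bool (λ { true → φ ; false → ψ })

  module _ (𝔄 : Structure) {α : Fin k → Carrier 𝔄} {φ ψ : Formula k} where
    ∧-intro : Sat 𝔄 α φ → Sat 𝔄 α ψ → Sat 𝔄 α (φ ∧F ψ)
    ∧-intro s t true = s
    ∧-intro s t false = t

    ∧-left : Sat 𝔄 α (φ ∧F ψ) → Sat 𝔄 α φ
    ∧-left h = h true

    ∧-right : Sat 𝔄 α (φ ∧F ψ) → Sat 𝔄 α ψ
    ∧-right h = h false

  module _ (𝔄 : Structure) {α : Fin k → Carrier 𝔄} {s : Fin k} {φ : Formula k} where
    ∃-intro : ∀ a → Sat 𝔄 (update α s a) φ → Sat 𝔄 α (existsF s φ)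
    ∃-intro a h = (λ _ → a) , (λ { {F.zero} {F.zero} _ → refl }) , (λ { F.zero → h })

    ∃-elim : Sat 𝔄 α (existsF s φ) → Σ (Carrier 𝔄) λ a → Sat 𝔄 (update α s a) φ
    ∃-elim (f , _ , h) = f F.zero , h F.zero

  free-∧ : ∀ {x φ ψ} → Free x (φ ∧F ψ) → Free x φ ⊎ Free x ψ
  free-∧ (conj true fr) = inj₁ fr
  free-∧ (conj false fr) = inj₂ fr

  free-∃ : ∀ {x s φ} → Free x (existsF s φ) → ¬ x ≡ s × Free x φ
  free-∃ (cnt x≢s fr) = x≢s , fr

module TupleAssignment {k m : ℕ} (m≤k : m ≤ k) where
  var : Fin m → Fin k
  var i = F.inject≤ i m≤k

  var<m : ∀ i → toℕ (var i) < m
  var<m i = subst (_< m) (sym (FP.toℕ-inject≤ i m≤k)) (FP.toℕ<n i)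

  assign : ∀ {A : Set} → (Fin m → A) → A → Fin k → A
  assign a d x with toℕ x ℕP.<? m
  ... | yes x<m = a (fromℕ< x<m)
  ... | no _ = d

  assign-tuple : ∀ {A : Set} (a : Fin m → A) d x (x<m : toℕ x < m) → assign a d x ≡ a (fromℕ< x<m)
  assign-tuple a d x x<m with toℕ x ℕP.<? m
  ... | yes x<m' = cong a (FP.toℕ-injective (trans (FP.toℕ-fromℕ< x<m') (sym (FP.toℕ-fromℕ< x<m))))
  ... | no x≮m = ⊥-elim (x≮m x<m)

  assign-var : ∀ {A : Set} (a : Fin m → A) d i → assign a d (var i) ≡ a i
  assign-var a d i = trans (assign-tuple a d (var i) (var<m i))
    (cong a (FP.toℕ-injective (trans (FP.toℕ-fromℕ< (var<m i)) (FP.toℕ-inject≤ i m≤k))))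

  transfer : ∀ {𝔄 : Structure} {a b} → TupleEquiv k 𝔄 m a b → (φ : Formula k) →
    (∀ x → Free x φ → toℕ x < m) → ∀ d d' → Sat 𝔄 (assign a d) φ → Sat 𝔄 (assign b d') φ
  transfer te φ fv d d' = proj₁ (te φ fv (assign _ d) (assign _ d') (assign-tuple _ d) (assign-tuple _ d'))

T-irrelevant : ∀ {b} (x y : T b) → x ≡ y
T-irrelevant {true} tt tt = refl

module CFIBasics (q : ℕ) .{{_ : NonZero q}} {n : ℕ} (G : Graph n) (d : Fin n → Fin q) where
  open Congruence q
  open SumCongruence q

  Node : Set
  Node = CFINode q G d

  Rl : Sym → Node → Node → Set
  Rl = CFIRel q G d

  adj-sym : ∀ {x y} → T (adj G x y) → T (adj G y x)
  adj-sym {x} {y} = subst T (Graph.sym G x y)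

  edgeNode-injective : ∀ {x y p i x' y' p' i'} → edgeNode {q} {G = G} {d = d} x y p i ≡ edgeNode x' y' p' i' →
    (x ≡ x') × (y ≡ y') × (i ≡ i')
  edgeNode-injective refl = refl , refl , refl

  edgeNode-irrelevant : ∀ {x y} (p p' : T (adj G x y)) i → edgeNode {q} {G = G} {d = d} x y p i ≡ edgeNode x y p' i
  edgeNode-irrelevant {x} {y} p p' i = cong (λ t → edgeNode x y t i) (T-irrelevant p p')

  eqNode-cong : ∀ {v ρ ρ'} (r : T (validEq q G d v ρ)) (r' : T (validEq q G d v ρ')) → ρ ≡ ρ' →
    eqNode v ρ r ≡ eqNode v ρ' r'
  eqNode-cong {v} {ρ} r r' refl = cong (eqNode {q} {G = G} {d = d} v ρ) (T-irrelevant r r')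

  private
    allB-elim : ∀ {A : Set} (f : A → Bool) xs → T (allB q G d f xs) → ∀ x → x ∈ˡ xs → T (f x)
    allB-elim f (y List.∷ xs) t x (here refl) = proj₁ (Equivalence.to BP.T-∧ t)
    allB-elim f (y List.∷ xs) t x (there x∈) = allB-elim f xs (proj₂ (Equivalence.to BP.T-∧ t)) x x∈

    allB-intro : ∀ {A : Set} (f : A → Bool) xs → (∀ x → T (f x)) → T (allB q G d f xs)
    allB-intro f List.[] h = tt
    allB-intro f (y List.∷ xs) h = Equivalence.from BP.T-∧ (h y , allB-intro f xs h)

  valid-off : ∀ v ρ → T (validEq q G d v ρ) → ∀ w → adj G v w ≡ false → toℕ (lookup ρ w) ≡ 0
  valid-off v ρ r w not-adj with allB-elim _ (List.allFin n) (proj₁ (Equivalence.to BP.T-∧ r)) w (∈-allFin w)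
  ... | t rewrite not-adj = ℕP.≡ᵇ⇒≡ _ 0 t

  valid-sum : ∀ v ρ → T (validEq q G d v ρ) → Vec.sum (Vec.map toℕ ρ) ℕ.% q ≡ toℕ (d v)
  valid-sum v ρ r = ℕP.≡ᵇ⇒≡ _ _ (proj₂ (Equivalence.to BP.T-∧ r))

  valid-∑ : ∀ v ρ → T (validEq q G d v ρ) → ∑ (λ w → + toℕ (lookup ρ w)) ≈ + toℕ (d v)
  valid-∑ v ρ r = ≈-trans (≈-reflexive (sym (vec-sum ρ))) (%-to-≈ _ _ (valid-sum v ρ r))

  valid-intro : ∀ v ρ → (∀ w → adj G v w ≡ false → toℕ (lookup ρ w) ≡ 0) →
    Vec.sum (Vec.map toℕ ρ) ℕ.% q ≡ toℕ (d v) → T (validEq q G d v ρ)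
  valid-intro v ρ off sum = Equivalence.from BP.T-∧ (allB-intro _ (List.allFin n) entry , ℕP.≡⇒≡ᵇ _ _ sum)
    where
    entry : ∀ w → T (adj G v w ∨ (toℕ (lookup ρ w) ℕ.≡ᵇ 0))
    entry w with adj G v w in eq
    ... | true = tt
    ... | false = ℕP.≡⇒≡ᵇ _ 0 (off w eq)

  shift : ℤ → Fin q → Fin q
  shift t i = reduce (+ toℕ i + t)

  shift-≈ : ∀ t i → + toℕ (shift t i) ≈ + toℕ i + t
  shift-≈ t i = reduce-≈ _

  shift-inverse : ∀ t t' i → t' ≡ - t → shift t' (shift t i) ≡ i
  shift-inverse t t' i e = reduce-unique _ i (≈-sym (≈-trans (≈-+ (shift-≈ t i) (≈-reflexive e)) (≈-reflexive (cancel (+ toℕ i) t))))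
    where cancel : ∀ a b → a + b + - b ≡ a
          cancel = solve-∀

  shift-zero : ∀ i → shift (+ 0) i ≡ i
  shift-zero i = reduce-unique _ i (≈-reflexive (sym (ℤP.+-identityʳ _)))

  shift-shift : ∀ t t' i → shift t' (shift t i) ≡ shift (t + t') i
  shift-shift t t' i = sym (reduce-unique _ _
    (≈-trans (shift-≈ t' (shift t i)) (≈-trans (≈-+ (shift-≈ t i) (≈-refl {t'})) (≈-reflexive (ℤP.+-assoc (+ toℕ i) t t')))))

  record Flow : Set where
    field
      c : Fin n → Fin n → ℤ
      antisym : ∀ v w → c w v ≡ - c v w
      off : ∀ v w → adj G v w ≡ false → c v w ≡ + 0
      balanced : ∀ v → ∑ (c v) ≈ + 0
  open Flow public

  negate-flow : Flow → Flow
  negate-flow F = record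
    { c = λ v w → - c F v w
    ; antisym = λ v w → cong -_ (antisym F v w)
    ; off = λ v w e → cong -_ (off F v w e)
    ; balanced = λ v → ≈-trans (≈-reflexive (∑-neg (c F v))) (≈-neg (balanced F v)) }

  shift-row : (Fin n → ℤ) → Vec (Fin q) n → Vec (Fin q) n
  shift-row cv ρ = tabulate (λ w → shift (cv w) (lookup ρ w))

  lookup-shift-row : ∀ cv ρ w → lookup (shift-row cv ρ) w ≡ shift (cv w) (lookup ρ w)
  lookup-shift-row cv ρ w = VP.lookup∘tabulate _ w

  valid-shift : (F : Flow) → ∀ v ρ → T (validEq q G d v ρ) → T (validEq q G d v (shift-row (c F v) ρ))
  valid-shift F v ρ r = valid-intro v ρ' shifted-off (%-from-≈ _ _ (FP.toℕ<n (d v)) shifted-sum)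
    where
    open ≈-Reasoning
    ρ' = shift-row (c F v) ρ
    shifted-off : ∀ w → adj G v w ≡ false → toℕ (lookup ρ' w) ≡ 0
    shifted-off w not-adj = residue-unique (FP.toℕ<n _) (ℕP.<-≤-trans ℕP.0<1+n (FP.toℕ<n (d v))) (begin
      + toℕ (lookup ρ' w)                ≡⟨ cong (λ t → + toℕ t) (lookup-shift-row (c F v) ρ w) ⟩
      + toℕ (shift (c F v w) (lookup ρ w)) ≈⟨ shift-≈ (c F v w) (lookup ρ w) ⟩
      + toℕ (lookup ρ w) + c F v w       ≡⟨ cong₂ (λ a b → + a + b) (valid-off v ρ r w not-adj) (off F v w not-adj) ⟩
      + 0                                ∎)
    shifted-sum : + Vec.sum (Vec.map toℕ ρ') ≈ + toℕ (d v)
    shifted-sum = begin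
      + Vec.sum (Vec.map toℕ ρ')                               ≡⟨ vec-sum ρ' ⟩
      ∑ (λ w → + toℕ (lookup ρ' w))                            ≈⟨ ∑-≈ (λ w → ≈-trans (≈-reflexive (cong (λ t → + toℕ t) (lookup-shift-row (c F v) ρ w)))
                                                                                      (shift-≈ (c F v w) (lookup ρ w))) ⟩
      ∑ (λ w → + toℕ (lookup ρ w) + c F v w)                   ≡⟨ ∑-distrib-+ (λ w → + toℕ (lookup ρ w)) (c F v) ⟩
      ∑ (λ w → + toℕ (lookup ρ w)) + ∑ (c F v)                 ≈⟨ ≈-+ (valid-∑ v ρ r) (balanced F v) ⟩
      + toℕ (d v) + + 0                                        ≡⟨ ℤP.+-identityʳ _ ⟩
      + toℕ (d v)                                              ∎

  flow-map : Flow → Node → Node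
  flow-map F (edgeNode v w p i) = edgeNode v w p (shift (c F v w) i)
  flow-map F (eqNode v ρ r) = eqNode v (shift-row (c F v) ρ) (valid-shift F v ρ r)

  flow-map-inverse : ∀ (F F' : Flow) → (∀ v w → c F' v w ≡ - c F v w) → ∀ x → flow-map F' (flow-map F x) ≡ x
  flow-map-inverse F F' F'≡-F (edgeNode v w p i) = cong (edgeNode v w p) (shift-inverse _ _ i (F'≡-F v w))
  flow-map-inverse F F' F'≡-F (eqNode v ρ r) = eqNode-cong _ r
    (trans (VP.tabulate-cong (λ w → trans (cong (shift (c F' v w)) (lookup-shift-row (c F v) ρ w)) (shift-inverse _ _ _ (F'≡-F v w))))
           (VP.tabulate∘lookup ρ))

  flow-map-preserves : (F : Flow) → ∀ r x y → Rl r x y → Rl r (flow-map F x) (flow-map F y)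
  flow-map-preserves F .⪯ˢ _ _ (pre-ee le) = pre-ee le
  flow-map-preserves F .⪯ˢ _ _ pre-eq = pre-eq
  flow-map-preserves F .⪯ˢ _ _ (pre-qq le) = pre-qq le
  flow-map-preserves F .Cˢ (edgeNode v w p i) (edgeNode v w p j) (cyc j≡i+1) = cyc (sym (%-from-≈ _ _ (FP.toℕ<n _) (begin
      + (toℕ (shift t i) ℕ.+ 1)   ≡⟨ ℤP.pos-+ (toℕ (shift t i)) 1 ⟩
      + toℕ (shift t i) + + 1     ≈⟨ ≈-+ (shift-≈ t i) (≈-refl {+ 1}) ⟩
      + toℕ i + t + + 1           ≡⟨ swap (+ toℕ i) t (+ 1) ⟩
      + toℕ i + + 1 + t           ≡⟨ cong (_+ t) (sym (ℤP.pos-+ (toℕ i) 1)) ⟩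
      + (toℕ i ℕ.+ 1) + t         ≈⟨ ≈-+ (≈-sym (%-≈ _)) (≈-refl {t}) ⟩
      + ((toℕ i ℕ.+ 1) ℕ.% q) + t ≡⟨ cong (λ s → + s + t) (sym j≡i+1) ⟩
      + toℕ j + t                 ≈⟨ ≈-sym (shift-≈ t j) ⟩
      + toℕ (shift t j)           ∎)))
    where
    open ≈-Reasoning
    t = c F v w
    swap : ∀ a b c → a + b + c ≡ a + c + b
    swap = solve-∀
  flow-map-preserves F .Iˢ (edgeNode v w p i) (edgeNode w v p' j) (inv i+j≡0) = inv (%-from-≈ _ _ (ℕP.<-≤-trans ℕP.0<1+n (FP.toℕ<n i)) (begin
      + (toℕ (shift t i) ℕ.+ toℕ (shift t' j))  ≡⟨ ℤP.pos-+ (toℕ (shift t i)) (toℕ (shift t' j)) ⟩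
      + toℕ (shift t i) + + toℕ (shift t' j)    ≈⟨ ≈-+ (shift-≈ t i) (shift-≈ t' j) ⟩
      + toℕ i + t + (+ toℕ j + t')              ≡⟨ cong (λ s → + toℕ i + t + (+ toℕ j + s)) (antisym F v w) ⟩
      + toℕ i + t + (+ toℕ j + - t)             ≡⟨ cancel (+ toℕ i) t (+ toℕ j) ⟩
      + toℕ i + + toℕ j                         ≡⟨ sym (ℤP.pos-+ (toℕ i) (toℕ j)) ⟩
      + (toℕ i ℕ.+ toℕ j)                       ≈⟨ %-to-≈ _ _ i+j≡0 ⟩
      + 0                                       ∎))
    where
    open ≈-Reasoning
    t = c F v w
    t' = c F w v
    cancel : ∀ a b c → a + b + (c + - b) ≡ a + c
    cancel = solve-∀
  flow-map-preserves F .Rˢ (eqNode v ρ r) (edgeNode v w p _) rel =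
    subst (λ t → Rl Rˢ (eqNode v (shift-row (c F v) ρ) (valid-shift F v ρ r)) (edgeNode v w p t)) (lookup-shift-row (c F v) ρ w) rel

  flow-automorphism : Flow → Node ↔ Node
  flow-automorphism F = mk↔ₛ′ (flow-map F) (flow-map (negate-flow F))
    (flow-map-inverse (negate-flow F) F (λ v w → sym (ℤP.neg-involutive _)))
    (flow-map-inverse F (negate-flow F) (λ v w → refl))

  flow-automorphism-is-automorphism : (F : Flow) → IsAutomorphism (CFI q G d) (flow-automorphism F)
  flow-automorphism-is-automorphism F r x y = mk⇔ (flow-map-preserves F r x y)
    (λ h → subst₂ (Rl r) (flow-map-inverse F (negate-flow F) (λ v w → refl) x) (flow-map-inverse F (negate-flow F) (λ v w → refl) y)
      (flow-map-preserves (negate-flow F) r _ _ h))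

list-pigeonhole : ∀ {A : Set} {K} (L : List A) (f : Fin K → A) → Injective _≡_ _≡_ f → (∀ j → f j ∈ˡ L) → K ≤ length L
list-pigeonhole L f f-inj f∈L = FP.injective⇒≤ {f = λ j → index (f∈L j)}
  (λ {i} {j} e → f-inj (SetoidMembership.index-injective (setoid _) (f∈L i) (f∈L j) e))

lookup-injective : ∀ {A : Set} (xs : List A) → Unique xs → ∀ {i j} → List.lookup xs i ≡ List.lookup xs j → i ≡ j
lookup-injective (x ∷ xs) (x∉ ∷ u) {F.zero} {F.zero} e = refl
lookup-injective (x ∷ xs) (x∉ ∷ u) {F.zero} {F.suc j} e = ⊥-elim (All.lookup x∉ (∈-lookup j) e)
lookup-injective (x ∷ xs) (x∉ ∷ u) {F.suc i} {F.zero} e = ⊥-elim (All.lookup x∉ (∈-lookup i) (sym e))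
lookup-injective (x ∷ xs) (x∉ ∷ u) {F.suc i} {F.suc j} e = cong F.suc (lookup-injective xs u e)

module EdgeOrder {n : ℕ} where
  infix 4 _<E_
  _<E_ : (Fin n × Fin n) → (Fin n × Fin n) → Set
  (x' , y') <E (x , y) = x' <ᶠ x ⊎ (x' ≡ x × y' <ᶠ y)

  _<E?_ : ∀ e e' → Dec (e <E e')
  (x' , y') <E? (x , y) with x' FP.<? x
  ... | yes x'<x = yes (inj₁ x'<x)
  ... | no x'≮x with x' ≟ᶠ x | y' FP.<? y
  ... | yes x'≡x | yes y'<y = yes (inj₂ (x'≡x , y'<y))
  ... | yes _ | no y'≮y = no λ { (inj₁ x'<x) → x'≮x x'<x ; (inj₂ (_ , y'<y)) → y'≮y y'<y }
  ... | no x'≢x | _ = no λ { (inj₁ x'<x) → x'≮x x'<x ; (inj₂ (x'≡x , _)) → x'≢x x'≡x }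

  <E-irrefl : ∀ {e} → ¬ e <E e
  <E-irrefl (inj₁ x<x) = ℕP.<-irrefl refl x<x
  <E-irrefl (inj₂ (_ , y<y)) = ℕP.<-irrefl refl y<y

  <E-trans : ∀ {e e' e''} → e <E e' → e' <E e'' → e <E e''
  <E-trans (inj₁ p) (inj₁ p') = inj₁ (ℕP.<-trans p p')
  <E-trans (inj₁ p) (inj₂ (refl , _)) = inj₁ p
  <E-trans (inj₂ (refl , _)) (inj₁ p') = inj₁ p'
  <E-trans (inj₂ (refl , p)) (inj₂ (refl , p')) = inj₂ (refl , ℕP.<-trans p p')

  data Trichotomy (e e' : Fin n × Fin n) : Set where
    less : e <E e' → Trichotomy e e'
    equal : e ≡ e' → Trichotomy e e'
    greater : e' <E e → Trichotomy e e'

  <E-compare : ∀ e e' → Trichotomy e e'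
  <E-compare (x' , y') (x , y) with FP.<-cmp x' x
  ... | tri< p _ _ = less (inj₁ p)
  ... | tri> _ _ p = greater (inj₁ p)
  ... | tri≈ _ refl _ with FP.<-cmp y' y
  ... | tri< p _ _ = less (inj₂ (refl , p))
  ... | tri≈ _ refl _ = equal refl
  ... | tri> _ _ p = greater (inj₂ (refl , p))

module CFILocal (q : ℕ) .{{_ : NonZero q}} {n : ℕ} (G : Graph n) (d : Fin n → Fin q) where
  open Congruence q
  open CFIBasics q G d
  open EdgeOrder {n}

  negate : Fin q → Fin q
  negate i = reduce (- + toℕ i)

  some-residue : Fin q
  some-residue = fromℕ< (ℕ.>-nonZero⁻¹ q)

  C-inversion : ∀ {u w} → Rl Cˢ u w → Σ (Fin n) λ x → Σ (Fin n) λ y → Σ (T (adj G x y)) λ p → Σ (Fin q) λ i →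
    (u ≡ edgeNode x y p i) × (w ≡ edgeNode x y p (shift (+ 1) i))
  C-inversion (cyc {v} {w} {p} {i} {j} j≡i+1) = v , w , p , i , refl , cong (edgeNode v w p) (sym (reduce-unique _ j
    (≈-sym (≈-trans (≈-reflexive (sym (ℤP.pos-+ (toℕ i) 1))) (%-to-≈ _ _ (sym j≡i+1))))))

  C-successor : ∀ x y p i → Rl Cˢ (edgeNode x y p i) (edgeNode x y p (shift (+ 1) i))
  C-successor x y p i = cyc (sym (%-from-≈ _ _ (FP.toℕ<n _)
    (≈-trans (≈-reflexive (ℤP.pos-+ (toℕ i) 1)) (≈-sym (shift-≈ (+ 1) i)))))

  I-inversion : ∀ {u w x y p i} → Rl Iˢ u w → u ≡ edgeNode x y p i →
    Σ (T (adj G y x)) λ p' → w ≡ edgeNode y x p' (negate i)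
  I-inversion (inv {v} {w} {p} {i} {p'} {j} i+j≡0) refl = p' , cong (edgeNode w v p') (sym (reduce-unique _ j j≈-i))
    where
    open ≈-Reasoning
    rearrange : ∀ a b → b ≡ (a + b) - a
    rearrange = solve-∀
    j≈-i : + toℕ j ≈ - + toℕ i
    j≈-i = begin
      + toℕ j                       ≡⟨ rearrange (+ toℕ i) (+ toℕ j) ⟩
      (+ toℕ i + + toℕ j) - + toℕ i ≡⟨ cong (_- + toℕ i) (sym (ℤP.pos-+ (toℕ i) (toℕ j))) ⟩
      + (toℕ i ℕ.+ toℕ j) - + toℕ i ≈⟨ ≈-+ (%-to-≈ _ _ i+j≡0) (≈-refl { - + toℕ i}) ⟩
      + 0 - + toℕ i                 ≡⟨ ℤP.+-identityˡ _ ⟩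
      - + toℕ i                     ∎

  I-partner : ∀ x y p p' i → Rl Iˢ (edgeNode x y p i) (edgeNode y x p' (negate i))
  I-partner x y p p' i = inv (%-from-≈ _ 0 (ℕ.>-nonZero⁻¹ q)
    (≈-trans (≈-reflexive (ℤP.pos-+ (toℕ i) _))
      (≈-trans (≈-+ (≈-refl {+ toℕ i}) (reduce-≈ (- + toℕ i))) (≈-reflexive (ℤP.+-inverseʳ (+ toℕ i))))))

  R-inversion : ∀ {u w v ρ r} → Rl Rˢ u w → u ≡ eqNode v ρ r →
    Σ (Fin n) λ y → Σ (T (adj G v y)) λ p → w ≡ edgeNode v y p (lookup ρ y)
  R-inversion (rel {w = w} {p = p}) refl = w , p , refl

  StrictlyBelow : Node → Node → Set
  StrictlyBelow s z = Rl ⪯ˢ s z × ¬ Rl ⪯ˢ z s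

  below-edge⇒ : ∀ {s x y p i} → StrictlyBelow s (edgeNode x y p i) →
    Σ (Fin n) λ x' → Σ (Fin n) λ y' → Σ (T (adj G x' y')) λ p' → Σ (Fin q) λ i' →
      (s ≡ edgeNode x' y' p' i') × ((x' , y') <E (x , y))
  below-edge⇒ {edgeNode x' y' p' i'} (pre-ee (inj₁ x'<x) , _) = x' , y' , p' , i' , refl , inj₁ x'<x
  below-edge⇒ {edgeNode x' y' p' i'} {x} {y} (pre-ee (inj₂ (refl , y'≤y)) , not-above) with y' ≟ᶠ y
  ... | yes refl = ⊥-elim (not-above (pre-ee (inj₂ (refl , ℕP.≤-refl))))
  ... | no y'≢y = x' , y' , p' , i' , refl , inj₂ (refl , FP.≤∧≢⇒< y'≤y y'≢y)

  below-edge⇐ : ∀ {x' y' p' i' x y p i} → (x' , y') <E (x , y) → StrictlyBelow (edgeNode x' y' p' i') (edgeNode x y p i)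
  below-edge⇐ (inj₁ x'<x) = pre-ee (inj₁ x'<x) ,
    λ { (pre-ee (inj₁ x<x')) → ℕP.<-asym x'<x x<x' ; (pre-ee (inj₂ (refl , _))) → ℕP.<-irrefl refl x'<x }
  below-edge⇐ (inj₂ (refl , y'<y)) = pre-ee (inj₂ (refl , ℕP.<⇒≤ y'<y)) ,
    λ { (pre-ee (inj₁ x<x)) → ℕP.<-irrefl refl x<x ; (pre-ee (inj₂ (_ , y≤y'))) → ℕP.<⇒≱ y'<y y≤y' }

  Triple : Set
  Triple = Fin n × Fin n × Fin q

  private
    cons-if-edge : (x y : Fin n) (i : Fin q) (b : Bool) → b ≡ adj G x y → List Node → List Node
    cons-if-edge x y i true e l = edgeNode x y (subst T e tt) i ∷ l
    cons-if-edge x y i false e l = l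

    code : Node → Maybe Triple
    code (edgeNode x y p i) = just (x , y , i)
    code (eqNode _ _ _) = nothing

    is-edge? : (t : Triple) → Dec (T (adj G (proj₁ t) (proj₁ (proj₂ t))))
    is-edge? t = T? _

  edge-nodes : List Triple → List Node
  edge-nodes [] = []
  edge-nodes ((x , y , i) ∷ ts) = cons-if-edge x y i (adj G x y) refl (edge-nodes ts)

  private
    code-edge-nodes : ∀ ts → map code (edge-nodes ts) ≡ map just (filter is-edge? ts)
    code-edge-nodes [] = refl
    code-edge-nodes ((x , y , i) ∷ ts) = by-cases (adj G x y) refl
      where
      by-cases : ∀ b (e : b ≡ adj G x y) → map code (cons-if-edge x y i b e (edge-nodes ts)) ≡ map just (filter is-edge? ((x , y , i) ∷ ts))
      by-cases true e rewrite sym e = cong (just (x , y , i) ∷_) (code-edge-nodes ts)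
      by-cases false e rewrite sym e = code-edge-nodes ts

  edge-nodes-unique : ∀ ts → Unique ts → Unique (edge-nodes ts)
  edge-nodes-unique ts u = UniqueP.map⁻
    (subst Unique (sym (code-edge-nodes ts)) (UniqueP.map⁺ (λ { refl → refl }) (UniqueP.filter⁺ is-edge? u)))

  edge-nodes-∈ : ∀ ts x y i (p : T (adj G x y)) → (x , y , i) ∈ˡ ts → edgeNode x y p i ∈ˡ edge-nodes ts
  edge-nodes-∈ ((x , y , i) ∷ ts) x y i p (here refl) = by-cases (adj G x y) refl
    where
    by-cases : ∀ b (e : b ≡ adj G x y) → edgeNode x y p i ∈ˡ cons-if-edge x y i b e (edge-nodes ts)
    by-cases true e = here (edgeNode-irrelevant p _ i)
    by-cases false e = ⊥-elim (subst T (sym e) p)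
  edge-nodes-∈ ((x' , y' , i') ∷ ts) x y i p (there t∈) = by-cases (adj G x' y') refl
    where
    by-cases : ∀ b (e : b ≡ adj G x' y') → edgeNode x y p i ∈ˡ cons-if-edge x' y' i' b e (edge-nodes ts)
    by-cases true e = there (edge-nodes-∈ ts x y i p t∈)
    by-cases false e = edge-nodes-∈ ts x y i p t∈

  edge-nodes-∈⁻ : ∀ ts u → u ∈ˡ edge-nodes ts →
    Σ (Fin n) λ x → Σ (Fin n) λ y → Σ (T (adj G x y)) λ p → Σ (Fin q) λ i → (u ≡ edgeNode x y p i) × ((x , y , i) ∈ˡ ts)
  edge-nodes-∈⁻ ((x , y , i) ∷ ts) u u∈ = by-cases (adj G x y) refl u∈
    where
    by-cases : ∀ b (e : b ≡ adj G x y) → u ∈ˡ cons-if-edge x y i b e (edge-nodes ts) →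
      Σ (Fin n) λ x' → Σ (Fin n) λ y' → Σ (T (adj G x' y')) λ p → Σ (Fin q) λ i' →
        (u ≡ edgeNode x' y' p i') × ((x' , y' , i') ∈ˡ ((x , y , i) ∷ ts))
    by-cases true e (here u≡) = x , y , subst T e tt , i , u≡ , here refl
    by-cases true e (there u∈') with edge-nodes-∈⁻ ts u u∈'
    ... | x' , y' , p , i' , u≡ , t∈ = x' , y' , p , i' , u≡ , there t∈
    by-cases false e u∈' with edge-nodes-∈⁻ ts u u∈'
    ... | x' , y' , p , i' , u≡ , t∈ = x' , y' , p , i' , u≡ , there t∈

  all-triples : List Triple
  all-triples = cartesianProduct (allFin n) (cartesianProduct (allFin n) (allFin q))

  private
    below? : (e : Fin n × Fin n) (t : Triple) → Dec ((proj₁ t , proj₁ (proj₂ t)) <E e)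
    below? e t = (proj₁ t , proj₁ (proj₂ t)) <E? e

  nodes-below : Fin n × Fin n → List Node
  nodes-below e = edge-nodes (filter (below? e) all-triples)

  rank : Fin n × Fin n → ℕ
  rank e = length (nodes-below e)

  nodes-below-unique : ∀ e → Unique (nodes-below e)
  nodes-below-unique e = edge-nodes-unique _ (UniqueP.filter⁺ (below? e)
    (UniqueP.cartesianProduct⁺ (UniqueP.allFin⁺ n) (UniqueP.cartesianProduct⁺ (UniqueP.allFin⁺ n) (UniqueP.allFin⁺ q))))

  nodes-below-sound : ∀ e u → u ∈ˡ nodes-below e →
    Σ (Fin n) λ x → Σ (Fin n) λ y → Σ (T (adj G x y)) λ p → Σ (Fin q) λ i → (u ≡ edgeNode x y p i) × ((x , y) <E e)
  nodes-below-sound e u u∈ with edge-nodes-∈⁻ (filter (below? e) all-triples) u u∈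
  ... | x , y , p , i , u≡ , t∈ = x , y , p , i , u≡ , proj₂ (∈-filter⁻ (below? e) {xs = all-triples} t∈)

  nodes-below-complete : ∀ e x y p i → (x , y) <E e → edgeNode x y p i ∈ˡ nodes-below e
  nodes-below-complete e x y p i xy<e = edge-nodes-∈ _ x y i p (∈-filter⁺ (below? e)
    (∈-cartesianProduct⁺ (∈-allFin x) (∈-cartesianProduct⁺ (∈-allFin y) (∈-allFin i))) xy<e)

  -- rank is strictly monotone on edges: (x,y)_0 is below e' but not below (x,y).
  rank-monotone : ∀ e e' → T (adj G (proj₁ e) (proj₂ e)) → e <E e' → suc (rank e) ≤ rank e'
  rank-monotone (x , y) e' p xy<e' = list-pigeonhole (nodes-below e') f f-inj f∈
    where
    f : Fin (suc (rank (x , y))) → Node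
    f F.zero = edgeNode x y p some-residue
    f (F.suc j) = List.lookup (nodes-below (x , y)) j
    fresh : ∀ j → ¬ edgeNode x y p some-residue ≡ List.lookup (nodes-below (x , y)) j
    fresh j e with nodes-below-sound (x , y) _ (∈-lookup j)
    ... | x' , y' , p' , i' , u≡ , xy'<xy with trans e u≡
    ... | refl = <E-irrefl xy'<xy
    f-inj : Injective _≡_ _≡_ f
    f-inj {F.zero} {F.zero} e = refl
    f-inj {F.zero} {F.suc j} e = ⊥-elim (fresh j e)
    f-inj {F.suc i} {F.zero} e = ⊥-elim (fresh i (sym e))
    f-inj {F.suc i} {F.suc j} e = cong F.suc (lookup-injective (nodes-below (x , y)) (nodes-below-unique (x , y)) e)
    f∈ : ∀ j → f j ∈ˡ nodes-below e'
    f∈ F.zero = nodes-below-complete e' x y p some-residue xy<e'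
    f∈ (F.suc j) with nodes-below-sound (x , y) _ (∈-lookup j)
    ... | x' , y' , p' , i' , u≡ , xy'<xy = subst (_∈ˡ nodes-below e') (sym u≡) (nodes-below-complete e' x' y' p' i' (<E-trans xy'<xy xy<e'))

module EdgeClassFormula (q : ℕ) .{{_ : NonZero q}} {n : ℕ} (G : Graph n) (d : Fin n → Fin q) where
  open CFIBasics q G d
  open CFILocal q G d
  open EdgeOrder {n}

  𝔄 : Structure
  𝔄 = CFI q G d

  module _ {k : ℕ} where
    strictly-below : Fin k → Fin k → Formula k
    strictly-below s z = relF ⪯ˢ s z ∧F negF (relF ⪯ˢ z s)

    -- "z is an edge node of class e": z has a C-successor and exactly rank e
    -- nodes lie strictly below it (s is an auxiliary bound variable).
    edge-class : (Fin n × Fin n) → Fin k → Fin k → Formula k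
    edge-class e z s = existsF s (relF Cˢ z s)
                       ∧F (cntF (rank e) s (strictly-below s z) ∧F negF (cntF (suc (rank e)) s (strictly-below s z)))

    strictly-below-free : ∀ {x s z} → ¬ x ≡ s → Free x (strictly-below s z) → x ≡ z
    strictly-below-free x≢s fr with free-∧ fr
    ... | inj₁ relˡ = ⊥-elim (x≢s refl)
    ... | inj₁ relʳ = refl
    ... | inj₂ (neg relˡ) = refl
    ... | inj₂ (neg relʳ) = ⊥-elim (x≢s refl)

    edge-class-free : ∀ {x e z s} → Free x (edge-class e z s) → x ≡ z
    edge-class-free fr with free-∧ fr
    ... | inj₁ fr₁ with free-∃ fr₁
    ... | _ , relˡ = refl
    ... | x≢s , relʳ = ⊥-elim (x≢s refl)
    edge-class-free fr | inj₂ fr₂ with free-∧ fr₂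
    ... | inj₁ (cnt x≢s fr₃) = strictly-below-free x≢s fr₃
    ... | inj₂ (neg (cnt x≢s fr₃)) = strictly-below-free x≢s fr₃

    strictly-below⇒ : ∀ (α : Fin k → Node) s z a → ¬ s ≡ z → Sat 𝔄 (update α s a) (strictly-below s z) → StrictlyBelow a (α z)
    strictly-below⇒ α s z a s≢z h =
      subst₂ (Rl ⪯ˢ) (update-same α s a) (update-other α s a z s≢z) (h true) ,
      λ z⪯a → h false (subst₂ (Rl ⪯ˢ) (sym (update-other α s a z s≢z)) (sym (update-same α s a)) z⪯a)

    strictly-below⇐ : ∀ (α : Fin k → Node) s z a → ¬ s ≡ z → StrictlyBelow a (α z) → Sat 𝔄 (update α s a) (strictly-below s z)
    strictly-below⇐ α s z a s≢z (a⪯z , _) true = subst₂ (Rl ⪯ˢ) (sym (update-same α s a)) (sym (update-other α s a z s≢z)) a⪯z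
    strictly-below⇐ α s z a s≢z (_ , z⋠a) false = λ z⪯a → z⋠a (subst₂ (Rl ⪯ˢ) (update-other α s a z s≢z) (update-same α s a) z⪯a)

    count-below⇒ : ∀ (α : Fin k → Node) s z K x y p i → ¬ s ≡ z → α z ≡ edgeNode x y p i →
      Sat 𝔄 α (cntF K s (strictly-below s z)) → K ≤ rank (x , y)
    count-below⇒ α s z K x y p i s≢z αz≡ (f , f-inj , sat) = list-pigeonhole (nodes-below (x , y)) f f-inj f∈
      where
      f∈ : ∀ j → f j ∈ˡ nodes-below (x , y)
      f∈ j with below-edge⇒ (subst (StrictlyBelow (f j)) αz≡ (strictly-below⇒ α s z (f j) s≢z (sat j)))
      ... | x' , y' , p' , i' , fj≡ , xy'<xy = subst (_∈ˡ nodes-below (x , y)) (sym fj≡) (nodes-below-complete (x , y) x' y' p' i' xy'<xy)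

    count-below⇐ : ∀ (α : Fin k → Node) s z K x y p i → ¬ s ≡ z → α z ≡ edgeNode x y p i →
      K ≤ rank (x , y) → Sat 𝔄 α (cntF K s (strictly-below s z))
    count-below⇐ α s z K x y p i s≢z αz≡ K≤rank = f , f-inj , λ j → strictly-below⇐ α s z (f j) s≢z (f-below j)
      where
      f : Fin K → Node
      f j = List.lookup (nodes-below (x , y)) (F.inject≤ j K≤rank)
      f-inj : Injective _≡_ _≡_ f
      f-inj e = FP.inject≤-injective K≤rank K≤rank _ _ (lookup-injective (nodes-below (x , y)) (nodes-below-unique (x , y)) e)
      f-below : ∀ j → StrictlyBelow (f j) (α z)
      f-below j with nodes-below-sound (x , y) (f j) (∈-lookup (F.inject≤ j K≤rank))
      ... | x' , y' , p' , i' , fj≡ , xy'<xy = subst₂ StrictlyBelow (sym fj≡) (sym αz≡) (below-edge⇐ xy'<xy)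

    edge-class-complete : ∀ (α : Fin k → Node) z s x y p i → ¬ s ≡ z → α z ≡ edgeNode x y p i → Sat 𝔄 α (edge-class (x , y) z s)
    edge-class-complete α z s x y p i s≢z αz≡ true = ∃-intro 𝔄 {α} {s} {relF Cˢ z s} _
      (subst₂ (Rl Cˢ) (trans (sym αz≡) (sym (update-other α s _ z s≢z))) (sym (update-same α s _)) (C-successor x y p i))
    edge-class-complete α z s x y p i s≢z αz≡ false true = count-below⇐ α s z (rank (x , y)) x y p i s≢z αz≡ ℕP.≤-refl
    edge-class-complete α z s x y p i s≢z αz≡ false false h = ℕP.<-irrefl refl (count-below⇒ α s z _ x y p i s≢z αz≡ h)

    edge-class-sound : ∀ (α : Fin k → Node) z s e → T (adj G (proj₁ e) (proj₂ e)) → ¬ s ≡ z → Sat 𝔄 α (edge-class e z s) →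
      Σ (T (adj G (proj₁ e) (proj₂ e))) λ p → Σ (Fin q) λ i → α z ≡ edgeNode (proj₁ e) (proj₂ e) p i
    edge-class-sound α z s e e-edge s≢z h with ∃-elim 𝔄 {α} {s} {relF Cˢ z s} (h true)
    ... | a , z→a with C-inversion z→a
    ... | x , y , p , i , αz≡′ , _ with trans (sym (update-other α s a z s≢z)) αz≡′
    ... | αz≡ with <E-compare (x , y) e
    ... | equal refl = p , i , αz≡
    ... | less xy<e = ⊥-elim (ℕP.<-irrefl refl (ℕP.<-≤-trans (rank-monotone (x , y) e p xy<e)
                                 (count-below⇒ α s z (rank e) x y p i s≢z αz≡ (h false true))))
    ... | greater e<xy = ⊥-elim (h false false (count-below⇐ α s z (suc (rank e)) x y p i s≢z αz≡ (rank-monotone e (x , y) e-edge e<xy)))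

module LinkFormulas (q : ℕ) .{{_ : NonZero q}} {n : ℕ} (G : Graph n) (d : Fin n → Fin q) where
  open CFIBasics q G d
  open CFILocal q G d
  open EdgeClassFormula q G d

  advance : ℕ → Node → Node
  advance t (edgeNode x y p i) = edgeNode x y p (shift (+ t) i)
  advance t (eqNode v ρ r) = eqNode v ρ r

  advance-suc : ∀ t x y p i → advance t (edgeNode x y p (shift (+ 1) i)) ≡ advance (suc t) (edgeNode x y p i)
  advance-suc t x y p i = cong (edgeNode x y p) (trans (shift-shift (+ 1) (+ t) i) (cong (λ u → shift u i) (sym (ℤP.pos-+ 1 t))))

  module _ {k : ℕ} where
    -- "z' is reached from z by t C-steps", using three variables alternately.
    C-chain : ℕ → Fin k → Fin k → Fin k → Formula k
    C-chain zero z z' s = eqF z z'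
    C-chain (suc t) z z' s = existsF s (relF Cˢ z s ∧F C-chain t s z' z)

    C-chain-free : ∀ t {y z z' s : Fin k} → Free y (C-chain t z z' s) → (y ≡ z) ⊎ (y ≡ z')
    C-chain-free zero eqˡ = inj₁ refl
    C-chain-free zero eqʳ = inj₂ refl
    C-chain-free (suc t) fr with free-∃ fr
    ... | y≢s , fr₁ with free-∧ fr₁
    ... | inj₁ relˡ = inj₁ refl
    ... | inj₁ relʳ = ⊥-elim (y≢s refl)
    ... | inj₂ fr₂ with C-chain-free t fr₂
    ... | inj₁ y≡s = ⊥-elim (y≢s y≡s)
    ... | inj₂ y≡z' = inj₂ y≡z'

    C-chain-sound : ∀ t (α : Fin k → Node) z z' s → ¬ z ≡ z' → ¬ z ≡ s → ¬ z' ≡ s →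
      Sat 𝔄 α (C-chain t z z' s) → α z' ≡ advance t (α z)
    C-chain-sound zero α z z' s _ _ _ h with α z
    ... | edgeNode x y p i = trans (sym h) (cong (edgeNode x y p) (sym (shift-zero i)))
    ... | eqNode v ρ r = sym h
    C-chain-sound (suc t) α z z' s z≢z' z≢s z'≢s h with ∃-elim 𝔄 {α} {s} {relF Cˢ z s ∧F C-chain t s z' z} h
    ... | a , h' with C-inversion (subst₂ (Rl Cˢ) (update-other α s a z (λ e → z≢s (sym e))) (update-same α s a)
                                     (∧-left 𝔄 {update α s a} {relF Cˢ z s} {C-chain t s z' z} h'))
    ... | x , y , p , i , αz≡ , a≡ =
      begin
        α z'                                        ≡⟨ sym (update-other α s a z' (λ e → z'≢s (sym e))) ⟩
        update α s a z'                             ≡⟨ rest ⟩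
        advance t (update α s a s)                  ≡⟨ cong (advance t) (trans (update-same α s a) a≡) ⟩
        advance t (edgeNode x y p (shift (+ 1) i))  ≡⟨ advance-suc t x y p i ⟩
        advance (suc t) (edgeNode x y p i)          ≡⟨ cong (advance (suc t)) (sym αz≡) ⟩
        advance (suc t) (α z)                       ∎
      where
      open ≡-Reasoning
      rest = C-chain-sound t (update α s a) s z' z (λ e → z'≢s (sym e)) (λ e → z≢s (sym e)) (λ e → z≢z' (sym e))
               (∧-right 𝔄 {update α s a} {relF Cˢ z s} {C-chain t s z' z} h')

    C-chain-complete : ∀ t (α : Fin k → Node) z z' s → ¬ z ≡ z' → ¬ z ≡ s → ¬ z' ≡ s →
      ∀ x y p i → α z ≡ edgeNode x y p i → α z' ≡ advance t (α z) → Sat 𝔄 α (C-chain t z z' s)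
    C-chain-complete zero α z z' s _ _ _ x y p i αz≡ h =
      trans αz≡ (trans (cong (edgeNode x y p) (sym (shift-zero i))) (trans (cong (advance 0) (sym αz≡)) (sym h)))
    C-chain-complete (suc t) α z z' s z≢z' z≢s z'≢s x y p i αz≡ h =
      ∃-intro 𝔄 {α} {s} {relF Cˢ z s ∧F C-chain t s z' z} a (∧-intro 𝔄 {update α s a} {relF Cˢ z s} {C-chain t s z' z}
        (subst₂ (Rl Cˢ) (trans (sym αz≡) (sym (update-other α s a z (λ e → z≢s (sym e))))) (sym (update-same α s a)) (C-successor x y p i))
        (C-chain-complete t (update α s a) s z' z (λ e → z'≢s (sym e)) (λ e → z≢s (sym e)) (λ e → z≢z' (sym e)) x y p (shift (+ 1) i)
          (update-same α s a)
          (trans (update-other α s a z' (λ e → z'≢s (sym e))) (trans h (trans (cong (advance (suc t)) αz≡)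
            (trans (sym (advance-suc t x y p i)) (cong (advance t) (sym (update-same α s a)))))))))
      where a = edgeNode x y p (shift (+ 1) i)

  -- The four ways a tuple element X determines an edge node z (s is auxiliary):
  -- z = X; z is the I-partner of edge node X; z is the edge (v,w) that the
  -- equation node X at v points to; or z is the I-partner of that edge node.
  data Kind : Set where
    self partner : Kind
    pointed partner-of-pointed : Fin n → Fin n → Kind

  module _ {k : ℕ} where
    determines : Kind → Fin k → Fin k → Fin k → Formula k
    determines self X z s = eqF z X
    determines partner X z s = relF Iˢ X z
    determines (pointed v w) X z s = relF Rˢ X z ∧F edge-class (v , w) z s
    determines (partner-of-pointed v w) X z s = existsF s (relF Rˢ X s ∧F (edge-class (v , w) s z ∧F relF Iˢ s z))

    determines-free : ∀ K {y X z s} → Free y (determines K X z s) → (y ≡ X) ⊎ (y ≡ z)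
    determines-free self eqˡ = inj₂ refl
    determines-free self eqʳ = inj₁ refl
    determines-free partner relˡ = inj₁ refl
    determines-free partner relʳ = inj₂ refl
    determines-free (pointed v w) fr with free-∧ fr
    ... | inj₁ relˡ = inj₁ refl
    ... | inj₁ relʳ = inj₂ refl
    ... | inj₂ fr' = inj₂ (edge-class-free fr')
    determines-free (partner-of-pointed v w) fr with free-∃ fr
    ... | y≢s , fr₁ with free-∧ fr₁
    ... | inj₁ relˡ = inj₁ refl
    ... | inj₁ relʳ = ⊥-elim (y≢s refl)
    ... | inj₂ fr₂ with free-∧ fr₂
    ... | inj₁ fr₃ = ⊥-elim (y≢s (edge-class-free fr₃))
    ... | inj₂ relˡ = ⊥-elim (y≢s refl)
    ... | inj₂ relʳ = inj₂ refl

    partner⇐ : ∀ (α : Fin k → Node) X z s x y p p' i → α X ≡ edgeNode x y p i → α z ≡ edgeNode y x p' (negate i) →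
      Sat 𝔄 α (determines partner X z s)
    partner⇐ α X z s x y p p' i αX≡ αz≡ = subst₂ (Rl Iˢ) (sym αX≡) (sym αz≡) (I-partner x y p p' i)

    partner⇒ : ∀ (α : Fin k → Node) X z s x y p i → α X ≡ edgeNode x y p i → Sat 𝔄 α (determines partner X z s) →
      Σ (T (adj G y x)) λ p' → α z ≡ edgeNode y x p' (negate i)
    partner⇒ α X z s x y p i αX≡ h = I-inversion h αX≡

    pointed⇐ : ∀ (α : Fin k → Node) X z s v w ρ r p → ¬ s ≡ z → α X ≡ eqNode v ρ r → α z ≡ edgeNode v w p (lookup ρ w) →
      Sat 𝔄 α (determines (pointed v w) X z s)
    pointed⇐ α X z s v w ρ r p s≢z αX≡ αz≡ = ∧-intro 𝔄 {α} {relF Rˢ X z} {edge-class (v , w) z s}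
      (subst₂ (Rl Rˢ) (sym αX≡) (sym αz≡) rel) (edge-class-complete α z s v w p (lookup ρ w) s≢z αz≡)

    pointed⇒ : ∀ (α : Fin k → Node) X z s v w ρ r → T (adj G v w) → ¬ s ≡ z → α X ≡ eqNode v ρ r →
      Sat 𝔄 α (determines (pointed v w) X z s) → Σ (T (adj G v w)) λ p → α z ≡ edgeNode v w p (lookup ρ w)
    pointed⇒ α X z s v w ρ r vw-edge s≢z αX≡ h
      with R-inversion (∧-left 𝔄 {α} {relF Rˢ X z} {edge-class (v , w) z s} h) αX≡
    ... | y , p , αz≡ with edge-class-sound α z s (v , w) vw-edge s≢z (∧-right 𝔄 {α} {relF Rˢ X z} {edge-class (v , w) z s} h)
    ... | _ , _ , αz≡′ with edgeNode-injective (trans (sym αz≡) αz≡′)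
    ... | _ , refl , _ = p , αz≡

    partner-of-pointed⇐ : ∀ (α : Fin k → Node) X z s v w ρ r p p' → ¬ X ≡ s → ¬ s ≡ z → α X ≡ eqNode v ρ r →
      α z ≡ edgeNode w v p' (negate (lookup ρ w)) → Sat 𝔄 α (determines (partner-of-pointed v w) X z s)
    partner-of-pointed⇐ α X z s v w ρ r p p' X≢s s≢z αX≡ αz≡ =
      ∃-intro 𝔄 {α} {s} {relF Rˢ X s ∧F (edge-class (v , w) s z ∧F relF Iˢ s z)} a
        (∧-intro 𝔄 {α'} {relF Rˢ X s} {edge-class (v , w) s z ∧F relF Iˢ s z}
          (subst₂ (Rl Rˢ) (trans (sym αX≡) (sym (update-other α s a X (λ e → X≢s (sym e))))) (sym (update-same α s a)) rel)
          (∧-intro 𝔄 {α'} {edge-class (v , w) s z} {relF Iˢ s z}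
            (edge-class-complete α' s z v w p (lookup ρ w) (λ e → s≢z (sym e)) (update-same α s a))
            (subst₂ (Rl Iˢ) (sym (update-same α s a)) (trans (sym αz≡) (sym (update-other α s a z s≢z)))
              (I-partner v w p p' (lookup ρ w)))))
      where
      a : Node
      a = edgeNode v w p (lookup ρ w)
      α' = update α s a

    partner-of-pointed⇒ : ∀ (α : Fin k → Node) X z s v w ρ r → T (adj G v w) → ¬ X ≡ s → ¬ s ≡ z → α X ≡ eqNode v ρ r →
      Sat 𝔄 α (determines (partner-of-pointed v w) X z s) → Σ (T (adj G w v)) λ p' → α z ≡ edgeNode w v p' (negate (lookup ρ w))
    partner-of-pointed⇒ α X z s v w ρ r vw-edge X≢s s≢z αX≡ h
      with ∃-elim 𝔄 {α} {s} {relF Rˢ X s ∧F (edge-class (v , w) s z ∧F relF Iˢ s z)} h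
    ... | a , h' with ∧-left 𝔄 {α'} {relF Rˢ X s} {rest} h' | ∧-right 𝔄 {α'} {relF Rˢ X s} {rest} h'
      where α' = update α s a
            rest = edge-class (v , w) s z ∧F relF Iˢ s z
    ... | X→s | h'' with R-inversion X→s (trans (update-other α s a X (λ e → X≢s (sym e))) αX≡)
    ... | y , p , a≡ with edge-class-sound (update α s a) s z (v , w) vw-edge (λ e → s≢z (sym e))
                            (∧-left 𝔄 {update α s a} {edge-class (v , w) s z} {relF Iˢ s z} h'')
    ... | _ , _ , a≡′ with edgeNode-injective (trans (sym a≡) a≡′)
    ... | _ , refl , _ with I-inversion (∧-right 𝔄 {update α s a} {edge-class (v , w) s z} {relF Iˢ s z} h'') a≡
    ... | p' , αz≡ = p' , trans (sym (update-other α s a z s≢z)) αz≡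

module Constraints (n : ℕ) where
  data Constraint : Set where
    on-edge : (v w : Fin n) → ℤ → Constraint
    on-row : (v : Fin n) → (Fin n → ℤ) → Constraint

  data Requires : Constraint → Fin n → Fin n → ℤ → Set where
    edge-forward : ∀ {x y t} → Requires (on-edge x y t) x y t
    edge-backward : ∀ {x y t} → Requires (on-edge y x t) x y (- t)
    row-forward : ∀ {x y δ} → Requires (on-row x δ) x y (δ y)
    row-backward : ∀ {x y δ} → Requires (on-row y δ) x y (- δ x)

  requires? : ∀ C x y → (Σ ℤ λ s → Requires C x y s) ⊎ (∀ s → ¬ Requires C x y s)
  requires? (on-edge v w t) x y with v ≟ᶠ x | w ≟ᶠ y
  ... | yes refl | yes refl = inj₁ (t , edge-forward)
  ... | yes refl | no w≢y with w ≟ᶠ x | v ≟ᶠ y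
  ...   | yes refl | yes refl = inj₁ (- t , edge-backward)
  ...   | no w≢x | _ = inj₂ λ { s edge-forward → w≢y refl ; s edge-backward → w≢x refl }
  ...   | yes _ | no v≢y = inj₂ λ { s edge-forward → w≢y refl ; s edge-backward → v≢y refl }
  requires? (on-edge v w t) x y | no v≢x | _ with w ≟ᶠ x | v ≟ᶠ y
  ...   | yes refl | yes refl = inj₁ (- t , edge-backward)
  ...   | no w≢x | _ = inj₂ λ { s edge-forward → v≢x refl ; s edge-backward → w≢x refl }
  ...   | yes _ | no v≢y = inj₂ λ { s edge-forward → v≢x refl ; s edge-backward → v≢y refl }
  requires? (on-row v δ) x y with v ≟ᶠ x
  ... | yes refl = inj₁ (δ y , row-forward)
  ... | no v≢x with v ≟ᶠ y
  ...   | yes refl = inj₁ (- δ x , row-backward)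
  ...   | no v≢y = inj₂ λ { s row-forward → v≢x refl ; s row-backward → v≢y refl }

  requires-flip : ∀ {C x y s} → Requires C x y s → Σ ℤ λ s' → Requires C y x s' × s' ≡ - s
  requires-flip {s = t} edge-forward = - t , edge-backward , refl
  requires-flip (edge-backward {t = t}) = t , edge-forward , sym (ℤP.neg-involutive t)
  requires-flip (row-forward {y = y} {δ = δ}) = - δ y , row-backward , refl
  requires-flip (row-backward {x = x} {δ = δ}) = δ x , row-forward , sym (ℤP.neg-involutive (δ x))

module Correspondence (q : ℕ) .{{_ : NonZero q}} {n : ℕ} (G : Graph n) (d : Fin n → Fin q) where
  open Congruence q
  open CFIBasics q G d
  open CFILocal q G d
  open EdgeClassFormula q G d
  open LinkFormulas q G d
  open Constraints n

  data SameClass : Node → Node → Set where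
    edge-class-pair : ∀ x y p p' i j → SameClass (edgeNode x y p i) (edgeNode x y p' j)
    equation-class-pair : ∀ v ρ r σ r' → SameClass (eqNode v ρ r) (eqNode v σ r')

  constraint : ∀ {u w} → SameClass u w → Constraint
  constraint (edge-class-pair x y p p' i j) = on-edge x y (+ toℕ j - + toℕ i)
  constraint (equation-class-pair v ρ r σ r') = on-row v (λ y → + toℕ (lookup σ y) - + toℕ (lookup ρ y))

  -- How a requirement of the constraint of (u,w) on the edge (x,y) is read
  -- off logically: a formula of kind K sends u to (x,y)_{ia} and forces its
  -- image under w to be (x,y)_{ib}, where s ≡ ib - ia.
  record Reading (k : ℕ) (u w : Node) (x y : Fin n) (s : ℤ) : Set where
    field
      K : Kind
      ia ib : Fin q
      s≈ : s ≈ + toℕ ib - + toℕ ia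
      complete : ∀ (α : Fin k → Node) X z s' → ¬ X ≡ z → ¬ X ≡ s' → ¬ s' ≡ z → α X ≡ u →
        ∀ p → α z ≡ edgeNode x y p ia → Sat 𝔄 α (determines K X z s')
      sound : ∀ (α : Fin k → Node) X z s' → ¬ X ≡ z → ¬ X ≡ s' → ¬ s' ≡ z → α X ≡ w →
        Sat 𝔄 α (determines K X z s') → Σ (T (adj G x y)) λ p → α z ≡ edgeNode x y p ib

  private
    neg-sub : ∀ a b → - (a - b) ≡ (- a) - (- b)
    neg-sub = solve-∀

    negate-difference : ∀ i j → - (+ toℕ j - + toℕ i) ≈ + toℕ (negate j) - + toℕ (negate i)
    negate-difference i j = ≈-trans (≈-reflexive (neg-sub (+ toℕ j) (+ toℕ i)))
      (≈-+ (≈-sym (reduce-≈ (- + toℕ j))) (≈-neg (≈-sym (reduce-≈ (- + toℕ i)))))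

  reading : ∀ {k u w x y s} (M : SameClass u w) → T (adj G x y) → Requires (constraint M) x y s → Reading k u w x y s
  reading (edge-class-pair x y p p' i j) _ edge-forward = record
    { K = self ; ia = i ; ib = j ; s≈ = ≈-refl
    ; complete = λ α X z s' _ _ _ αX≡ p'' αz≡ → trans αz≡ (trans (edgeNode-irrelevant p'' p i) (sym αX≡))
    ; sound = λ α X z s' _ _ _ αX≡ h → p' , trans h αX≡ }
  reading (edge-class-pair x y p p' i j) _ edge-backward = record
    { K = partner ; ia = negate i ; ib = negate j ; s≈ = negate-difference i j
    ; complete = λ α X z s' _ _ _ αX≡ p'' αz≡ → partner⇐ α X z s' x y p p'' i αX≡ αz≡
    ; sound = λ α X z s' _ _ _ αX≡ h → partner⇒ α X z s' x y p' j αX≡ h }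
  reading {y = y} (equation-class-pair v ρ r σ r') vy-edge row-forward = record
    { K = pointed v y ; ia = lookup ρ y ; ib = lookup σ y ; s≈ = ≈-refl
    ; complete = λ α X z s' _ _ s'≢z αX≡ p'' αz≡ → pointed⇐ α X z s' v y ρ r p'' s'≢z αX≡ αz≡
    ; sound = λ α X z s' _ _ s'≢z αX≡ h → pointed⇒ α X z s' v y σ r' vy-edge s'≢z αX≡ h }
  reading {x = x} (equation-class-pair v ρ r σ r') xv-edge row-backward = record
    { K = partner-of-pointed v x ; ia = negate (lookup ρ x) ; ib = negate (lookup σ x)
    ; s≈ = negate-difference (lookup ρ x) (lookup σ x)
    ; complete = λ α X z s' _ X≢s' s'≢z αX≡ p'' αz≡ → partner-of-pointed⇐ α X z s' v x ρ r (adj-sym xv-edge) p'' X≢s' s'≢z αX≡ αz≡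
    ; sound = λ α X z s' _ X≢s' s'≢z αX≡ h → partner-of-pointed⇒ α X z s' v x σ r' (adj-sym xv-edge) X≢s' s'≢z αX≡ h }

  row-constraint-admissible : ∀ {u w} (M : SameClass u w) v δ → constraint M ≡ on-row v δ →
    (∑ δ ≈ + 0) × (∀ y → adj G v y ≡ false → δ y ≈ + 0)
  row-constraint-admissible (edge-class-pair _ _ _ _ _ _) v δ ()
  row-constraint-admissible (equation-class-pair v ρ r σ r') .v .(λ y → + toℕ (lookup σ y) - + toℕ (lookup ρ y)) refl =
    balanced-difference , λ y not-adj → ≈-reflexive (cong₂ (λ s t → + s - + t) (valid-off v σ r' y not-adj) (valid-off v ρ r y not-adj))
    where
    open ≈-Reasoning
    balanced-difference : ∑ (λ y → + toℕ (lookup σ y) - + toℕ (lookup ρ y)) ≈ + 0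
    balanced-difference = begin
      ∑ (λ y → + toℕ (lookup σ y) - + toℕ (lookup ρ y))          ≡⟨ ∑-distrib-+ (λ y → + toℕ (lookup σ y)) (λ y → - + toℕ (lookup ρ y)) ⟩
      ∑ (λ y → + toℕ (lookup σ y)) + ∑ (λ y → - + toℕ (lookup ρ y)) ≡⟨ cong (λ t → ∑ (λ y → + toℕ (lookup σ y)) + t) (∑-neg (λ y → + toℕ (lookup ρ y))) ⟩
      ∑ (λ y → + toℕ (lookup σ y)) - ∑ (λ y → + toℕ (lookup ρ y)) ≈⟨ ≈-+ (valid-∑ v σ r') (≈-neg (valid-∑ v ρ r)) ⟩
      + toℕ (d v) - + toℕ (d v)                                 ≡⟨ ℤP.+-inverseʳ (+ toℕ (d v)) ⟩
      + 0                                                       ∎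

  flow-map-corresponds : (F : Flow) → ∀ {u w} (M : SameClass u w) →
    (∀ x y s → T (adj G x y) → Requires (constraint M) x y s → c F x y ≈ s) → flow-map F u ≡ w
  flow-map-corresponds F (edge-class-pair x y p p' i j) meets =
    trans (cong (edgeNode x y p) (reduce-unique _ j (≈-sym (≈-trans (≈-+ (≈-refl {+ toℕ i}) (meets x y _ p edge-forward))
                                                             (≈-reflexive (cancel (+ toℕ i) (+ toℕ j)))))))
          (edgeNode-irrelevant p p' j)
    where cancel : ∀ a b → a + (b - a) ≡ b
          cancel = solve-∀
  flow-map-corresponds F (equation-class-pair v ρ r σ r') meets =
    eqNode-cong (valid-shift F v ρ r) r' (trans (VP.tabulate-cong entry) (VP.tabulate∘lookup σ))
    where
    cancel : ∀ a b → a + (b - a) ≡ b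
    cancel = solve-∀
    entry : ∀ y → shift (c F v y) (lookup ρ y) ≡ lookup σ y
    entry y with adj G v y in vy
    ... | true = reduce-unique _ (lookup σ y) (≈-sym (≈-trans (≈-+ (≈-refl {+ toℕ (lookup ρ y)}) (meets v y _ (subst T (sym vy) tt) row-forward))
                   (≈-reflexive (cancel (+ toℕ (lookup ρ y)) (+ toℕ (lookup σ y))))))
    ... | false = reduce-unique _ (lookup σ y) (≈-reflexive (trans (cong +_ (valid-off v σ r' y vy))
                   (sym (cong₂ _+_ (cong +_ (valid-off v ρ r y vy)) (off F v y vy)))))

-- From C^k-equivalence of m-tuples ā, b̄ (with m + 2 ≤ k) we read off that
-- aᵢ and bᵢ lie in the same class, and that the resulting constraints on a
-- flow are consistent: two of them never prescribe different values mod q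
-- on the same edge.  Both facts transfer a formula with two extra variables.
module Extraction (q : ℕ) .{{_ : NonZero q}} {n : ℕ} (G : Graph n) (d : Fin n → Fin q)
  (k m : ℕ) (m+2≤k : suc (suc m) ≤ k) (a b : Fin m → CFINode q G d)
  (equiv : TupleEquiv k (CFI q G d) m a b) (neighbour : ∀ v → Σ (Fin n) λ w → T (adj G v w)) where
  open Congruence q
  open CFIBasics q G d
  open CFILocal q G d
  open EdgeClassFormula q G d
  open LinkFormulas q G d
  open Constraints n
  open Correspondence q G d
  open TupleAssignment (ℕP.≤-trans (ℕP.n≤1+n m) (ℕP.≤-trans (ℕP.n≤1+n (suc m)) m+2≤k))

  z₁ z₂ : Fin k
  z₁ = fromℕ< (ℕP.<-≤-trans (ℕP.n<1+n m) (ℕP.≤-trans (ℕP.n≤1+n (suc m)) m+2≤k))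
  z₂ = fromℕ< m+2≤k

  var≢z₁ : ∀ i → ¬ var i ≡ z₁
  var≢z₁ i e = ℕP.<-irrefl (trans (cong toℕ e) (FP.toℕ-fromℕ< _)) (var<m i)

  var≢z₂ : ∀ i → ¬ var i ≡ z₂
  var≢z₂ i e = ℕP.<-asym (var<m i) (subst (m <_) (trans (sym (FP.toℕ-fromℕ< _)) (cong toℕ (sym e))) (ℕP.n<1+n m))

  z₁≢z₂ : ¬ z₁ ≡ z₂
  z₁≢z₂ e = ℕP.<-irrefl (trans (sym (FP.toℕ-fromℕ< _)) (trans (cong toℕ e) (FP.toℕ-fromℕ< _))) (ℕP.n<1+n m)

  α₀ β₀ : Fin m → Fin k → Node
  α₀ i = assign a (a i)
  β₀ i = assign b (b i)

  -- aᵢ and bᵢ are in the same class: edge classes are defined by edge-class,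
  -- equation classes at v by pointing (via R) into the class of an edge (v,w).
  same-class-edge : ∀ i x y p ia → a i ≡ edgeNode x y p ia → SameClass (edgeNode x y p ia) (b i)
  same-class-edge i x y p ia ai≡
    with edge-class-sound (β₀ i) (var i) z₁ (x , y) p (≢-sym (var≢z₁ i)) (transfer equiv φ free (a i) (b i) sat-a)
    where
    φ = edge-class (x , y) (var i) z₁
    free : ∀ v → Free v φ → toℕ v < m
    free v fr = subst (λ t → toℕ t < m) (sym (edge-class-free fr)) (var<m i)
    sat-a : Sat 𝔄 (α₀ i) φ
    sat-a = edge-class-complete _ (var i) z₁ x y p ia (≢-sym (var≢z₁ i)) (trans (assign-var a (a i) i) ai≡)
  ... | p' , ib , bi≡ = subst (SameClass (edgeNode x y p ia)) (trans (sym bi≡) (assign-var b (b i) i)) (edge-class-pair x y p p' ia ib)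

  same-class-equation : ∀ i v ρ r → a i ≡ eqNode v ρ r → SameClass (eqNode v ρ r) (b i)
  same-class-equation i v ρ r ai≡ with ∃-elim 𝔄 {β₀ i} {z₁} {ψ} (transfer equiv φ free (a i) (b i) sat-a)
    where
    w = proj₁ (neighbour v)
    ψ = determines (pointed v w) (var i) z₁ z₂
    φ = existsF z₁ ψ
    free : ∀ y → Free y φ → toℕ y < m
    free y fr with free-∃ fr
    ... | y≢z₁ , fr' with determines-free (pointed v w) fr'
    ... | inj₁ refl = var<m i
    ... | inj₂ y≡z₁ = ⊥-elim (y≢z₁ y≡z₁)
    sat-a : Sat 𝔄 (α₀ i) φ
    sat-a = ∃-intro 𝔄 {α₀ i} {z₁} {ψ} (edgeNode v w (proj₂ (neighbour v)) (lookup ρ w))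
      (pointed⇐ _ (var i) z₁ z₂ v w ρ r (proj₂ (neighbour v)) (≢-sym z₁≢z₂)
        (trans (update-other _ z₁ _ (var i) (≢-sym (var≢z₁ i))) (trans (assign-var a (a i) i) ai≡)) (update-same _ z₁ _))
  ... | c , sat-b with update (β₀ i) z₁ c (var i) | update-other (β₀ i) z₁ c (var i) (≢-sym (var≢z₁ i))
                     | ∧-left 𝔄 {update (β₀ i) z₁ c} {relF Rˢ (var i) z₁} {edge-class (v , proj₁ (neighbour v)) z₁ z₂} sat-b
  ... | eqNode v' σ r' | bi≡ | X→z₁ with R-inversion X→z₁ refl
  ... | _ , _ , c≡ with edge-class-sound (update (β₀ i) z₁ c) z₁ z₂ (v , proj₁ (neighbour v)) (proj₂ (neighbour v)) (≢-sym z₁≢z₂)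
                          (∧-right 𝔄 {update (β₀ i) z₁ c} {relF Rˢ (var i) z₁} {edge-class (v , proj₁ (neighbour v)) z₁ z₂} sat-b)
  ... | _ , _ , c≡′ with edgeNode-injective (trans (sym c≡) c≡′)
  ... | refl , _ , _ = subst (SameClass (eqNode v ρ r)) (trans bi≡ (assign-var b (b i) i)) (equation-class-pair v ρ r σ r')

  same-class : ∀ i → SameClass (a i) (b i)
  same-class i with a i in ai≡
  ... | edgeNode x y p ia = same-class-edge i x y p ia ai≡
  ... | eqNode v ρ r = same-class-equation i v ρ r ai≡

  -- Let requirements of the constraints of (aᵢ,bᵢ) and (aⱼ,bⱼ)
  -- on the edge (x,y) be read off by Rᵢ and Rⱼ.  In ā the formula `link`
  -- says that the nodes read from aᵢ and aⱼ are t C-steps apart, where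
  -- t ≡ ja - ia; transferred to b̄ it gives jb ≡ ib + t, whence both
  -- requirements agree modulo q.
  module Link (i j : Fin m) {x y : Fin n} {s s' : ℤ} (xy-edge : T (adj G x y))
              (Rᵢ : Reading k (a i) (b i) x y s) (Rⱼ : Reading k (a j) (b j) x y s') where
    private
      module Rᵢ = Reading Rᵢ
      module Rⱼ = Reading Rⱼ

    D : ℤ
    D = + toℕ Rⱼ.ia - + toℕ Rᵢ.ia

    t : ℕ
    t = toℕ (reduce D)

    chain-part second-part : Formula k
    chain-part = determines Rⱼ.K (var j) z₂ z₁ ∧F C-chain t z₁ z₂ (var i)
    second-part = existsF z₂ chain-part

    first-part link : Formula k
    first-part = determines Rᵢ.K (var i) z₁ z₂ ∧F second-part
    link = existsF z₁ first-part

    link-free : ∀ v → Free v link → toℕ v < m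
    link-free v fr with free-∃ fr
    ... | v≢z₁ , fr₁ with free-∧ fr₁
    ... | inj₁ fr₂ with determines-free Rᵢ.K fr₂
    ...   | inj₁ refl = var<m i
    ...   | inj₂ v≡z₁ = ⊥-elim (v≢z₁ v≡z₁)
    link-free v fr | v≢z₁ , fr₁ | inj₂ fr₂ with free-∃ fr₂
    ... | v≢z₂ , fr₃ with free-∧ fr₃
    ... | inj₁ fr₄ with determines-free Rⱼ.K fr₄
    ...   | inj₁ refl = var<m j
    ...   | inj₂ v≡z₂ = ⊥-elim (v≢z₂ v≡z₂)
    link-free v fr | v≢z₁ , fr₁ | inj₂ fr₂ | v≢z₂ , fr₃ | inj₂ fr₄ with C-chain-free t fr₄
    ... | inj₁ v≡z₁ = ⊥-elim (v≢z₁ v≡z₁)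
    ... | inj₂ v≡z₂ = ⊥-elim (v≢z₂ v≡z₂)

    link-in-a : Sat 𝔄 (α₀ i) link
    link-in-a = ∃-intro 𝔄 {α₀ i} {z₁} {first-part} n₁ (∧-intro 𝔄 {α₁} {determines Rᵢ.K (var i) z₁ z₂} {second-part}
        (Rᵢ.complete α₁ (var i) z₁ z₂ (var≢z₁ i) (var≢z₂ i) (≢-sym z₁≢z₂)
          (trans (update-other (α₀ i) z₁ n₁ (var i) (≢-sym (var≢z₁ i))) (assign-var a (a i) i)) xy-edge (update-same (α₀ i) z₁ n₁))
        (∃-intro 𝔄 {α₁} {z₂} {chain-part} n₂ (∧-intro 𝔄 {α₂} {determines Rⱼ.K (var j) z₂ z₁} {C-chain t z₁ z₂ (var i)}
          (Rⱼ.complete α₂ (var j) z₂ z₁ (var≢z₂ j) (var≢z₁ j) z₁≢z₂ α₂-var-j xy-edge (update-same α₁ z₂ n₂))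
          (C-chain-complete t α₂ z₁ z₂ (var i) z₁≢z₂ (≢-sym (var≢z₁ i)) (≢-sym (var≢z₂ i)) x y xy-edge Rᵢ.ia α₂-z₁
            (trans (update-same α₁ z₂ n₂) (trans (cong (edgeNode x y xy-edge) (sym ia+t≡ja)) (cong (advance t) (sym α₂-z₁))))))))
      where
      n₁ = edgeNode x y xy-edge Rᵢ.ia
      n₂ = edgeNode x y xy-edge Rⱼ.ia
      α₁ = update (α₀ i) z₁ n₁
      α₂ = update α₁ z₂ n₂
      ia+t≡ja : shift (+ t) Rᵢ.ia ≡ Rⱼ.ia
      ia+t≡ja = reduce-unique _ Rⱼ.ia (≈-sym (≈-trans (≈-+ (≈-refl {+ toℕ Rᵢ.ia}) (reduce-≈ D)) (≈-reflexive (cancel (+ toℕ Rᵢ.ia) (+ toℕ Rⱼ.ia)))))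
        where cancel : ∀ a b → a + (b - a) ≡ b
              cancel = solve-∀
      α₂-var-j : α₂ (var j) ≡ a j
      α₂-var-j = trans (update-other α₁ z₂ n₂ (var j) (≢-sym (var≢z₂ j)))
                   (trans (update-other (α₀ i) z₁ n₁ (var j) (≢-sym (var≢z₁ j))) (assign-var a (a i) j))
      α₂-z₁ : α₂ z₁ ≡ n₁
      α₂-z₁ = trans (update-other α₁ z₂ n₂ z₁ (≢-sym z₁≢z₂)) (update-same (α₀ i) z₁ n₁)

    link-in-b : Sat 𝔄 (β₀ i) link → Rⱼ.ib ≡ shift (+ t) Rᵢ.ib
    link-in-b sat with ∃-elim 𝔄 {β₀ i} {z₁} {first-part} sat
    ... | c₁ , sat₁ with ∃-elim 𝔄 {β₁} {z₂} {chain-part} (∧-right 𝔄 {β₁} {determines Rᵢ.K (var i) z₁ z₂} {second-part} sat₁)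
      where β₁ = update (β₀ i) z₁ c₁
    ... | c₂ , sat₂ = proj₂ (proj₂ (edgeNode-injective (trans (sym (proj₂ at-z₂)) (trans chain (cong (advance t) at-z₁)))))
      where
      β₁ = update (β₀ i) z₁ c₁
      β₂ = update β₁ z₂ c₂
      read-i : Σ (T (adj G x y)) λ p → β₁ z₁ ≡ edgeNode x y p Rᵢ.ib
      read-i = Rᵢ.sound β₁ (var i) z₁ z₂ (var≢z₁ i) (var≢z₂ i) (≢-sym z₁≢z₂)
        (trans (update-other (β₀ i) z₁ c₁ (var i) (≢-sym (var≢z₁ i))) (assign-var b (b i) i))
        (∧-left 𝔄 {β₁} {determines Rᵢ.K (var i) z₁ z₂} {second-part} sat₁)
      at-z₂ : Σ (T (adj G x y)) λ p → β₂ z₂ ≡ edgeNode x y p Rⱼ.ib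
      at-z₂ = Rⱼ.sound β₂ (var j) z₂ z₁ (var≢z₂ j) (var≢z₁ j) z₁≢z₂
        (trans (update-other β₁ z₂ c₂ (var j) (≢-sym (var≢z₂ j)))
          (trans (update-other (β₀ i) z₁ c₁ (var j) (≢-sym (var≢z₁ j))) (assign-var b (b i) j)))
        (∧-left 𝔄 {β₂} {determines Rⱼ.K (var j) z₂ z₁} {C-chain t z₁ z₂ (var i)} sat₂)
      chain : β₂ z₂ ≡ advance t (β₂ z₁)
      chain = C-chain-sound t β₂ z₁ z₂ (var i) z₁≢z₂ (≢-sym (var≢z₁ i)) (≢-sym (var≢z₂ i))
        (∧-right 𝔄 {β₂} {determines Rⱼ.K (var j) z₂ z₁} {C-chain t z₁ z₂ (var i)} sat₂)
      at-z₁ : β₂ z₁ ≡ edgeNode x y (proj₁ read-i) Rᵢ.ib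
      at-z₁ = trans (update-other β₁ z₂ c₂ z₁ (≢-sym z₁≢z₂)) (proj₂ read-i)

    agree : s ≈ s'
    agree = begin
      s                                               ≈⟨ Rᵢ.s≈ ⟩
      + toℕ Rᵢ.ib - + toℕ Rᵢ.ia                       ≡⟨ rearrange (+ toℕ Rᵢ.ib) (+ toℕ Rᵢ.ia) (+ toℕ Rⱼ.ia) ⟩
      (+ toℕ Rᵢ.ib + D) - + toℕ Rⱼ.ia                 ≈⟨ ≈-+ (≈-sym (≈-+ (≈-refl {+ toℕ Rᵢ.ib}) (reduce-≈ D))) (≈-refl { - + toℕ Rⱼ.ia}) ⟩
      (+ toℕ Rᵢ.ib + + t) - + toℕ Rⱼ.ia               ≈⟨ ≈-+ (≈-sym (shift-≈ (+ t) Rᵢ.ib)) (≈-refl { - + toℕ Rⱼ.ia}) ⟩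
      + toℕ (shift (+ t) Rᵢ.ib) - + toℕ Rⱼ.ia         ≡⟨ cong (λ u → + toℕ u - + toℕ Rⱼ.ia) (sym jb≡) ⟩
      + toℕ Rⱼ.ib - + toℕ Rⱼ.ia                       ≈⟨ ≈-sym Rⱼ.s≈ ⟩
      s'                                              ∎
      where
      open ≈-Reasoning
      jb≡ = link-in-b (transfer equiv link link-free (a i) (b i) link-in-a)
      rearrange : ∀ ib ia ja → ib - ia ≡ (ib + (ja - ia)) - ja
      rearrange = solve-∀

  consistent : ∀ i j x y s s' → T (adj G x y) →
    Requires (constraint (same-class i)) x y s → Requires (constraint (same-class j)) x y s' → s ≈ s'
  consistent i j x y s s' xy-edge req req' = Link.agree i j xy-edge (reading (same-class i) xy-edge req) (reading (same-class j) xy-edge req')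

∣∪∣≤ : ∀ {n} (p r : Subset n) → ∣ p ∪ r ∣ ≤ ∣ p ∣ ℕ.+ ∣ r ∣
∣∪∣≤ [] [] = z≤n
∣∪∣≤ (true ∷ p) (true ∷ r) = s≤s (ℕP.≤-trans (∣∪∣≤ p r) (ℕP.+-monoʳ-≤ ∣ p ∣ (ℕP.n≤1+n ∣ r ∣)))
∣∪∣≤ (true ∷ p) (false ∷ r) = s≤s (∣∪∣≤ p r)
∣∪∣≤ (false ∷ p) (true ∷ r) = subst (suc ∣ p ∪ r ∣ ≤_) (sym (ℕP.+-suc ∣ p ∣ ∣ r ∣)) (s≤s (∣∪∣≤ p r))
∣∪∣≤ (false ∷ p) (false ∷ r) = ∣∪∣≤ p r

outside : ∀ {n} (p : Subset n) → ∣ p ∣ < n → Σ (Fin n) λ z → z ∉ p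
outside (false ∷ p) _ = F.zero , λ ()
outside (true ∷ p) (s≤s ∣p∣<n) with outside p ∣p∣<n
... | z , z∉p = F.suc z , λ { (there z∈p) → z∉p z∈p }

⋃ : ∀ {n m} → (Fin m → Subset n) → Subset n
⋃ {m = zero} f = ∅
⋃ {m = suc m} f = f F.zero ∪ ⋃ (λ i → f (F.suc i))

∈-⋃ : ∀ {n m} (f : Fin m → Subset n) {x} i → x ∈ f i → x ∈ ⋃ f
∈-⋃ f F.zero x∈ = SubsetP.x∈p∪q⁺ (inj₁ x∈)
∈-⋃ f (F.suc i) x∈ = SubsetP.x∈p∪q⁺ (inj₂ (∈-⋃ (λ j → f (F.suc j)) i x∈))

∈-⋃⁻ : ∀ {n m} (f : Fin m → Subset n) {x} → x ∈ ⋃ f → Σ (Fin m) λ i → x ∈ f i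
∈-⋃⁻ {m = zero} f x∈ = ⊥-elim (SubsetP.∉⊥ x∈)
∈-⋃⁻ {m = suc m} f x∈ with SubsetP.x∈p∪q⁻ (f F.zero) _ x∈
... | inj₁ x∈₀ = F.zero , x∈₀
... | inj₂ x∈' with ∈-⋃⁻ (λ j → f (F.suc j)) x∈'
... | i , x∈ᵢ = F.suc i , x∈ᵢ

∣⋃∣≤ : ∀ {n m} (f : Fin m → Subset n) → (∀ i → ∣ f i ∣ ≤ 1) → ∣ ⋃ f ∣ ≤ m
∣⋃∣≤ {n} {zero} f _ = ℕP.≤-reflexive (SubsetP.∣⊥∣≡0 n)
∣⋃∣≤ {m = suc m} f small = ℕP.≤-trans (∣∪∣≤ (f F.zero) _)
  (ℕP.+-mono-≤ (small F.zero) (∣⋃∣≤ (λ j → f (F.suc j)) (λ j → small (F.suc j))))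

module PathFlow {n : ℕ} (G : Graph n) where
  private
    δ-swap : ∀ (a x v y : Fin n) c → δ a x (δ v y c) ≡ δ v y (δ a x c)
    δ-swap a x v y c with a ≟ᶠ x | v ≟ᶠ y
    ... | yes _ | yes _ = refl
    ... | yes _ | no _ = refl
    ... | no _ | yes _ = refl
    ... | no _ | no _ = refl

    ∑-δ-outer : ∀ (a x : Fin n) (g : Fin n → ℤ) → ∑ (λ y → δ a x (g y)) ≡ δ a x (∑ g)
    ∑-δ-outer a x g with a ≟ᶠ x
    ... | yes _ = refl
    ... | no _ = ∑-zero {n} _ (λ _ → refl)

  edge-flow : Fin n → Fin n → Fin n → Fin n → ℤ
  edge-flow a v x y = δ a x (δ v y (+ 1)) - δ v x (δ a y (+ 1))

  edge-flow-antisym : ∀ a v x y → edge-flow a v y x ≡ - edge-flow a v x y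
  edge-flow-antisym a v x y = trans (cong₂ _-_ (δ-swap a y v x (+ 1)) (δ-swap v y a x (+ 1))) (swap (δ v x (δ a y (+ 1))) (δ a x (δ v y (+ 1))))
    where swap : ∀ s t → s - t ≡ - (t - s)
          swap = solve-∀

  edge-flow-out : ∀ a v x → ∑ (edge-flow a v x) ≡ δ a x (+ 1) - δ v x (+ 1)
  edge-flow-out a v x = trans (∑-distrib-+ (λ y → δ a x (δ v y (+ 1))) (λ y → - δ v x (δ a y (+ 1))))
    (cong₂ _+_ (trans (∑-δ-outer a x (λ y → δ v y (+ 1))) (cong (δ a x) (∑-δ v (+ 1))))
               (trans (∑-neg (λ y → δ v x (δ a y (+ 1)))) (cong -_ (trans (∑-δ-outer v x (λ y → δ a y (+ 1))) (cong (δ v x) (∑-δ a (+ 1)))))))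

  edge-flow-row : ∀ a v x y → ¬ a ≡ x → ¬ v ≡ x → edge-flow a v x y ≡ + 0
  edge-flow-row a v x y a≢x v≢x = cong₂ _-_ (δ-other a x _ a≢x) (δ-other v x _ v≢x)

  edge-flow-off : ∀ a v x y → T (adj G a v) → adj G x y ≡ false → edge-flow a v x y ≡ + 0
  edge-flow-off a v x y av-edge not-adj with a ≟ᶠ x | v ≟ᶠ y | v ≟ᶠ x | a ≟ᶠ y
  ... | yes refl | yes refl | _ | _ = ⊥-elim (subst T not-adj av-edge)
  ... | _ | _ | yes refl | yes refl = ⊥-elim (subst T (trans (sym (Graph.sym G x y)) not-adj) av-edge)
  ... | yes _ | no _ | yes _ | no _ = refl
  ... | yes _ | no _ | no _ | _ = refl
  ... | no _ | _ | yes _ | no _ = refl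
  ... | no _ | _ | no _ | _ = refl

  path-flow : ∀ {S a b} → PathAvoiding G S a b → Fin n → Fin n → ℤ
  path-flow here x y = + 0
  path-flow (step {a} {v} _ _ rest) x y = edge-flow a v x y + path-flow rest x y

  path-flow-antisym : ∀ {S a b} (P : PathAvoiding G S a b) x y → path-flow P y x ≡ - path-flow P x y
  path-flow-antisym here x y = refl
  path-flow-antisym (step {a} {v} _ _ rest) x y =
    trans (cong₂ _+_ (edge-flow-antisym a v x y) (path-flow-antisym rest x y)) (sym (ℤP.neg-distrib-+ (edge-flow a v x y) _))

  path-flow-off : ∀ {S a b} (P : PathAvoiding G S a b) x y → adj G x y ≡ false → path-flow P x y ≡ + 0
  path-flow-off here x y not-adj = refl
  path-flow-off (step {a} {v} av-edge _ rest) x y not-adj = cong₂ _+_ (edge-flow-off a v x y av-edge not-adj) (path-flow-off rest x y not-adj)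

  path-flow-out : ∀ {S a b} (P : PathAvoiding G S a b) x → ∑ (path-flow P x) ≡ δ a x (+ 1) - δ b x (+ 1)
  path-flow-out {a = a} here x = trans (∑-zero {n} _ (λ _ → refl)) (sym (ℤP.+-inverseʳ (δ a x (+ 1))))
  path-flow-out {b = b} (step {a} {v} _ _ rest) x =
    trans (∑-distrib-+ (edge-flow a v x) (path-flow rest x))
      (trans (cong₂ _+_ (edge-flow-out a v x) (path-flow-out rest x)) (telescope (δ a x (+ 1)) (δ v x (+ 1)) (δ b x (+ 1))))
    where telescope : ∀ s t u → (s - t) + (t - u) ≡ s - u
          telescope = solve-∀

  path-flow-row : ∀ {S a b} (P : PathAvoiding G S a b) x → x ∈ S → ¬ a ≡ x → ∀ y → path-flow P x y ≡ + 0
  path-flow-row here x x∈S a≢x y = refl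
  path-flow-row (step {a} {v} _ v∉S rest) x x∈S a≢x y =
    cong₂ _+_ (edge-flow-row a v x y a≢x v≢x) (path-flow-row rest x x∈S v≢x y)
    where v≢x : ¬ v ≡ x
          v≢x v≡x = v∉S (subst (_∈ _) (sym v≡x) x∈S)

-- Given m ≤ K - 2
-- admissible, consistent constraints on a K-connected graph, there is a flow
-- meeting all of them:
--  * first assign to each edge the value some constraint prescribes (0 if
--    none); this meets all constraints but may be unbalanced;
--  * the excess at vertices without row constraints is moved to a root r
--    along detours u → z → r that avoid every vertex touched by a constraint;
--    K-connectivity provides the detours, and r ends balanced because the
--    total excess vanishes.
module FlowExtension (q : ℕ) .{{_ : NonZero q}} {n : ℕ} (G : Graph n) (d : Fin n → Fin q)
  (K : ℕ) (connected : KConnected G K) (m : ℕ) (m+2≤K : suc (suc m) ≤ K)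
  (cs : Fin m → Constraints.Constraint n)
  (admissible : ∀ i v δ → cs i ≡ Constraints.on-row v δ →
     (Congruence._≈_ q (∑ δ) (+ 0)) × (∀ y → adj G v y ≡ false → Congruence._≈_ q (δ y) (+ 0)))
  (consistent : ∀ i j x y s s' → T (adj G x y) → Constraints.Requires n (cs i) x y s →
     Constraints.Requires n (cs j) x y s' → Congruence._≈_ q s s') where
  open Congruence q
  open SumCongruence q
  open CFIBasics q G d using (Flow; c; antisym; off; balanced)
  open Constraints n
  open PathFlow G

  m<K : m < K
  m<K = ℕP.<-≤-trans (ℕP.n<1+n m) (ℕP.≤-trans (ℕP.n≤1+n (suc m)) m+2≤K)

  first-requirement : ∀ {m'} (cs' : Fin m' → Constraint) x y →
    (Σ ℤ λ s → Σ (Fin m') λ i → Requires (cs' i) x y s) ⊎ (∀ i s → ¬ Requires (cs' i) x y s)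
  first-requirement {zero} cs' x y = inj₂ (λ ())
  first-requirement {suc m'} cs' x y with requires? (cs' F.zero) x y
  ... | inj₁ (s , req) = inj₁ (s , F.zero , req)
  ... | inj₂ none₀ with first-requirement (λ i → cs' (F.suc i)) x y
  ...   | inj₁ (s , i , req) = inj₁ (s , F.suc i , req)
  ...   | inj₂ none = inj₂ λ { F.zero s req → none₀ s req ; (F.suc i) s req → none i s req }

  prescribed : Fin n → Fin n → ℤ
  prescribed x y with first-requirement cs x y
  ... | inj₁ (s , _) = s
  ... | inj₂ _ = + 0

  prescribed-≈ : ∀ i x y s → T (adj G x y) → Requires (cs i) x y s → prescribed x y ≈ s
  prescribed-≈ i x y s xy-edge req with first-requirement cs x y
  ... | inj₁ (s' , j , req') = consistent j i x y s' s xy-edge req' req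
  ... | inj₂ none = ⊥-elim (none i s req)

  -- made exactly antisymmetric by choosing the value on the increasing orientation
  oriented : Fin n → Fin n → ℤ
  oriented x y with FP.<-cmp x y
  ... | tri< _ _ _ = prescribed x y
  ... | tri≈ _ _ _ = + 0
  ... | tri> _ _ _ = - prescribed y x

  oriented-antisym : ∀ x y → oriented y x ≡ - oriented x y
  oriented-antisym x y with FP.<-cmp x y | FP.<-cmp y x
  ... | tri< x<y _ _ | tri< y<x _ _ = ⊥-elim (ℕP.<-asym x<y y<x)
  ... | tri< x<y _ _ | tri≈ _ y≡x _ = ⊥-elim (ℕP.<-irrefl (cong F.toℕ (sym y≡x)) x<y)
  ... | tri< _ _ _ | tri> _ _ _ = refl
  ... | tri≈ _ x≡y _ | tri< y<x _ _ = ⊥-elim (ℕP.<-irrefl (cong F.toℕ (sym x≡y)) y<x)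
  ... | tri≈ _ _ _ | tri≈ _ _ _ = refl
  ... | tri≈ _ x≡y _ | tri> _ _ x<y = ⊥-elim (ℕP.<-irrefl (cong F.toℕ x≡y) x<y)
  ... | tri> _ _ _ | tri< _ _ _ = sym (ℤP.neg-involutive _)
  ... | tri> _ _ y<x | tri≈ _ y≡x _ = ⊥-elim (ℕP.<-irrefl (cong F.toℕ y≡x) y<x)
  ... | tri> _ _ y<x | tri> _ _ x<y = ⊥-elim (ℕP.<-asym y<x x<y)

  oriented-≈ : ∀ i x y s → T (adj G x y) → Requires (cs i) x y s → oriented x y ≈ s
  oriented-≈ i x y s xy-edge req with FP.<-cmp x y
  ... | tri< _ _ _ = prescribed-≈ i x y s xy-edge req
  ... | tri≈ _ refl _ = ⊥-elim (subst T (Graph.irrefl G x) xy-edge)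
  ... | tri> _ _ _ with requires-flip req
  ... | s' , req' , s'≡-s = ≈-trans (≈-neg (prescribed-≈ i y x s' (subst T (Graph.sym G x y) xy-edge) req'))
                               (≈-reflexive (trans (cong -_ s'≡-s) (ℤP.neg-involutive s)))

  base : Fin n → Fin n → ℤ
  base x y = if adj G x y then oriented x y else + 0

  base-antisym : ∀ x y → base y x ≡ - base x y
  base-antisym x y rewrite Graph.sym G y x | oriented-antisym x y with adj G x y
  ... | true = refl
  ... | false = refl

  base-off : ∀ x y → adj G x y ≡ false → base x y ≡ + 0
  base-off x y not-adj rewrite not-adj = refl

  base-meets : ∀ i x y s → T (adj G x y) → Requires (cs i) x y s → base x y ≈ s
  base-meets i x y s xy-edge req with adj G x y | xy-edge
  ... | true | _ = oriented-≈ i x y s xy-edge req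

  base-out : Fin n → ℤ
  base-out x = ∑ (base x)

  row-vertex : Constraint → Subset n
  row-vertex (on-row v _) = ⁅ v ⁆
  row-vertex (on-edge _ _ _) = ∅

  row-vertices : Subset n
  row-vertices = ⋃ (λ i → row-vertex (cs i))

  ∣row-vertices∣≤m : ∣ row-vertices ∣ ≤ m
  ∣row-vertices∣≤m = ∣⋃∣≤ _ (λ i → at-most-one (cs i))
    where at-most-one : ∀ C → ∣ row-vertex C ∣ ≤ 1
          at-most-one (on-row v _) = ℕP.≤-reflexive (SubsetP.∣⁅x⁆∣≡1 v)
          at-most-one (on-edge _ _ _) = subst (_≤ 1) (sym (SubsetP.∣⊥∣≡0 n)) z≤n

  ∈-row-vertices : ∀ i v δ → cs i ≡ on-row v δ → v ∈ row-vertices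
  ∈-row-vertices i v δ csᵢ≡ = ∈-⋃ (λ j → row-vertex (cs j)) i (subst (λ C → v ∈ row-vertex C) (sym csᵢ≡) (SubsetP.x∈⁅x⁆ v))

  ∈-row-vertices⁻ : ∀ v → v ∈ row-vertices → Σ (Fin m) λ i → Σ (Fin n → ℤ) λ δ → cs i ≡ on-row v δ
  ∈-row-vertices⁻ v v∈ with ∈-⋃⁻ (λ j → row-vertex (cs j)) v∈
  ... | i , v∈ᵢ = from-constraint (cs i) refl v∈ᵢ
    where
    from-constraint : ∀ C → cs i ≡ C → v ∈ row-vertex C → Σ (Fin m) λ i → Σ (Fin n → ℤ) λ δ → cs i ≡ on-row v δ
    from-constraint (on-row w δ) csᵢ≡ v∈w with SubsetP.x∈⁅y⁆⇒x≡y w v∈w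
    ... | refl = i , δ , csᵢ≡
    from-constraint (on-edge _ _ _) _ v∈∅ = ⊥-elim (SubsetP.∉⊥ v∈∅)

  base-balanced-at-rows : ∀ v → v ∈ row-vertices → base-out v ≈ + 0
  base-balanced-at-rows v v∈ with ∈-row-vertices⁻ v v∈
  ... | i , δ , csᵢ≡ = ≈-trans (∑-≈ entry) (proj₁ (admissible i v δ csᵢ≡))
    where
    entry : ∀ y → base v y ≈ δ y
    entry y = by-adjacency (adj G v y) refl
      where
      by-adjacency : ∀ b → adj G v y ≡ b → base v y ≈ δ y
      by-adjacency true vy = base-meets i v y (δ y) (subst T (sym vy) tt) (subst (λ C → Requires C v y (δ y)) (sym csᵢ≡) row-forward)
      by-adjacency false vy = ≈-trans (≈-reflexive (base-off v y vy)) (≈-sym (proj₂ (admissible i v δ csᵢ≡) y vy))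

  root-choice : Σ (Fin n) λ r → r ∉ row-vertices
  root-choice = outside row-vertices (ℕP.≤-<-trans ∣row-vertices∣≤m (ℕP.<-trans m<K (proj₁ connected)))

  r : Fin n
  r = proj₁ root-choice

  r∉rows : r ∉ row-vertices
  r∉rows = proj₂ root-choice

  excess : Fin n → ℤ
  excess u with u ∈? row-vertices
  ... | yes _ = + 0
  ... | no _ = base-out u

  excess-at-row : ∀ u → u ∈ row-vertices → excess u ≡ + 0
  excess-at-row u u∈ with u ∈? row-vertices
  ... | yes _ = refl
  ... | no u∉ = ⊥-elim (u∉ u∈)

  excess-off-row : ∀ u → u ∉ row-vertices → excess u ≡ base-out u
  excess-off-row u u∉ with u ∈? row-vertices
  ... | yes u∈ = ⊥-elim (u∉ u∈)
  ... | no _ = refl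

  -- The total excess vanishes: the total outflow of an antisymmetric
  -- assignment is 0, and the outflow at row vertices is 0 modulo q.
  total-excess : ∑ excess ≈ + 0
  total-excess = begin
      ∑ excess                                     ≡⟨ add-sub (∑ excess) (∑ row-part) ⟩
      (∑ excess + ∑ row-part) - ∑ row-part          ≡⟨ cong (_- ∑ row-part) (sym (∑-distrib-+ excess row-part)) ⟩
      ∑ (λ u → excess u + row-part u) - ∑ row-part  ≡⟨ cong (_- ∑ row-part) (sum-cong-≗ split) ⟩
      ∑ base-out - ∑ row-part                       ≈⟨ ≈-+ (≈-reflexive (∑∑-antisym base base-antisym)) (≈-neg (∑-≈ row-part≈0)) ⟩
      + 0 - ∑ {n} (λ _ → + 0)                       ≡⟨ cong (λ t → + 0 - t) (∑-zero {n} _ (λ _ → refl)) ⟩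
      + 0                                           ∎
    where
    open ≈-Reasoning
    row-part : Fin n → ℤ
    row-part u with u ∈? row-vertices
    ... | yes _ = base-out u
    ... | no _ = + 0
    add-sub : ∀ a b → a ≡ (a + b) - b
    add-sub = solve-∀
    split : ∀ u → excess u + row-part u ≡ base-out u
    split u with u ∈? row-vertices
    ... | yes _ = ℤP.+-identityˡ _
    ... | no _ = ℤP.+-identityʳ _
    row-part≈0 : ∀ u → row-part u ≈ + 0
    row-part≈0 u with u ∈? row-vertices
    ... | yes u∈ = base-balanced-at-rows u u∈
    ... | no _ = ≈-refl

  -- Vertices a detour for u must avoid: for each constraint, its row vertex,
  -- or for an edge constraint an endpoint other than u and r (if any).

  is-end? : ∀ (u v : Fin n) → Dec ((v ≡ u) ⊎ (v ≡ r))
  is-end? u v with v ≟ᶠ u | v ≟ᶠ r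
  ... | yes v≡u | _ = yes (inj₁ v≡u)
  ... | no _ | yes v≡r = yes (inj₂ v≡r)
  ... | no v≢u | no v≢r = no λ { (inj₁ v≡u) → v≢u v≡u ; (inj₂ v≡r) → v≢r v≡r }

  touched-by : Fin n → Constraint → Subset n
  touched-by u (on-row v _) = ⁅ v ⁆
  touched-by u (on-edge v w _) with is-end? u v | is-end? u w
  ... | no _ | _ = ⁅ v ⁆
  ... | yes _ | no _ = ⁅ w ⁆
  ... | yes _ | yes _ = ∅

  ∣touched-by∣≤1 : ∀ u C → ∣ touched-by u C ∣ ≤ 1
  ∣touched-by∣≤1 u (on-row v _) = ℕP.≤-reflexive (SubsetP.∣⁅x⁆∣≡1 v)
  ∣touched-by∣≤1 u (on-edge v w _) with is-end? u v | is-end? u w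
  ... | no _ | _ = ℕP.≤-reflexive (SubsetP.∣⁅x⁆∣≡1 v)
  ... | yes _ | no _ = ℕP.≤-reflexive (SubsetP.∣⁅x⁆∣≡1 w)
  ... | yes _ | yes _ = subst (_≤ 1) (sym (SubsetP.∣⊥∣≡0 n)) z≤n

  end-untouched : ∀ u x C → (x ≡ u ⊎ x ≡ r) → (∀ v δ → C ≡ on-row v δ → ¬ v ≡ x) → x ∉ touched-by u C
  end-untouched u x (on-row v _) _ no-row x∈ = no-row v _ refl (sym (SubsetP.x∈⁅y⁆⇒x≡y v x∈))
  end-untouched u x (on-edge v w _) x-end no-row x∈ with is-end? u v | is-end? u w
  ... | no v-inner | _ with SubsetP.x∈⁅y⁆⇒x≡y v x∈
  ...   | refl = v-inner x-end
  end-untouched u x (on-edge v w _) x-end no-row x∈ | yes _ | no w-inner with SubsetP.x∈⁅y⁆⇒x≡y w x∈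
  ...   | refl = w-inner x-end
  end-untouched u x (on-edge v w _) x-end no-row x∈ | yes _ | yes _ = SubsetP.∉⊥ x∈

  edge-touched : ∀ u v w t → (v ∈ touched-by u (on-edge v w t)) ⊎ ((w ∈ touched-by u (on-edge v w t)) ⊎
                                                                  (((v ≡ u) ⊎ (v ≡ r)) × ((w ≡ u) ⊎ (w ≡ r))))
  edge-touched u v w t with is-end? u v | is-end? u w
  ... | no _ | _ = inj₁ (SubsetP.x∈⁅x⁆ v)
  ... | yes _ | no _ = inj₂ (inj₁ (SubsetP.x∈⁅x⁆ w))
  ... | yes v-end | yes w-end = inj₂ (inj₂ (v-end , w-end))

  touched : Fin n → Subset n
  touched u = ⋃ (λ i → touched-by u (cs i))

  ∣touched∣≤m : ∀ u → ∣ touched u ∣ ≤ m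
  ∣touched∣≤m u = ∣⋃∣≤ _ (λ i → ∣touched-by∣≤1 u (cs i))

  end-∉-touched : ∀ u x → x ∉ row-vertices → (x ≡ u ⊎ x ≡ r) → x ∉ touched u
  end-∉-touched u x x∉rows x-end x∈ with ∈-⋃⁻ (λ i → touched-by u (cs i)) x∈
  ... | i , x∈ᵢ = end-untouched u x (cs i) x-end (λ v δ csᵢ≡ v≡x → x∉rows (subst (_∈ row-vertices) v≡x (∈-row-vertices i v δ csᵢ≡))) x∈ᵢ

  zero-row-antisym : (f : Fin n → Fin n → ℤ) → (∀ x y → f y x ≡ - f x y) → ∀ x → (∀ y → f x y ≡ + 0) → ∀ y → f y x ≡ + 0
  zero-row-antisym f f-antisym x row-zero y = trans (f-antisym x y) (cong -_ (row-zero y))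

  vanishes-on-constrained-edge : ∀ u (f : Fin n → Fin n → ℤ) → (∀ x y → f y x ≡ - f x y) →
    (∀ x y → adj G x y ≡ false → f x y ≡ + 0) → (∀ x → x ∈ touched u → ∀ y → f x y ≡ + 0) →
    (∀ y → f r y ≡ + 0) ⊎ (∀ y → f u y ≡ + 0) →
    ∀ v w → (v ∈ touched u ⊎ w ∈ touched u) ⊎ ((v ≡ u ⊎ v ≡ r) × (w ≡ u ⊎ w ≡ r)) → f v w ≡ + 0
  vanishes-on-constrained-edge u f f-antisym f-off rows end v w (inj₁ (inj₁ v∈)) = rows v v∈ w
  vanishes-on-constrained-edge u f f-antisym f-off rows end v w (inj₁ (inj₂ w∈)) = zero-row-antisym f f-antisym w (rows w w∈) v
  vanishes-on-constrained-edge u f f-antisym f-off rows end v w (inj₂ (inj₁ refl , inj₁ refl)) = f-off v v (Graph.irrefl G v)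
  vanishes-on-constrained-edge u f f-antisym f-off rows end v w (inj₂ (inj₂ refl , inj₂ refl)) = f-off v v (Graph.irrefl G v)
  vanishes-on-constrained-edge u f f-antisym f-off rows (inj₁ r-row) v w (inj₂ (inj₁ refl , inj₂ refl)) = zero-row-antisym f f-antisym r r-row u
  vanishes-on-constrained-edge u f f-antisym f-off rows (inj₂ u-row) v w (inj₂ (inj₁ refl , inj₂ refl)) = u-row r
  vanishes-on-constrained-edge u f f-antisym f-off rows (inj₁ r-row) v w (inj₂ (inj₂ refl , inj₁ refl)) = r-row u
  vanishes-on-constrained-edge u f f-antisym f-off rows (inj₂ u-row) v w (inj₂ (inj₂ refl , inj₁ refl)) = zero-row-antisym f f-antisym u u-row r

  -- The detour for u ∉ rows, u ≢ r: a path u → z avoiding touched u and r,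
  -- then z → r avoiding touched u and u, for some z outside touched u ∪ {u, r}.
  -- Passing through z keeps it off the edge {u, r}, which may be constrained.
  module Detour (u : Fin n) (u∉rows : u ∉ row-vertices) (u≢r : ¬ u ≡ r) where
    ∣touched∪⁅x⁆∣≤K : ∀ x → ∣ touched u ∪ ⁅ x ⁆ ∣ ≤ K
    ∣touched∪⁅x⁆∣≤K x = ℕP.≤-trans (∣∪∣≤ (touched u) ⁅ x ⁆)
      (ℕP.≤-trans (ℕP.+-mono-≤ (∣touched∣≤m u) (ℕP.≤-reflexive (SubsetP.∣⁅x⁆∣≡1 x))) (ℕP.≤-trans (ℕP.≤-reflexive (ℕP.+-comm m 1)) m<K))

    ∣touched∪ends∣<n : ∣ touched u ∪ (⁅ u ⁆ ∪ ⁅ r ⁆) ∣ < n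
    ∣touched∪ends∣<n = ℕP.≤-<-trans (ℕP.≤-trans size≤m+2 (ℕP.≤-trans (ℕP.≤-reflexive (ℕP.+-comm m 2)) m+2≤K)) (proj₁ connected)
      where
      size≤m+2 : ∣ touched u ∪ (⁅ u ⁆ ∪ ⁅ r ⁆) ∣ ≤ m ℕ.+ 2
      size≤m+2 = ℕP.≤-trans (∣∪∣≤ (touched u) _) (ℕP.+-mono-≤ (∣touched∣≤m u)
        (ℕP.≤-trans (∣∪∣≤ ⁅ u ⁆ ⁅ r ⁆) (ℕP.≤-reflexive (cong₂ ℕ._+_ (SubsetP.∣⁅x⁆∣≡1 u) (SubsetP.∣⁅x⁆∣≡1 r)))))

    z-choice : Σ (Fin n) λ z → z ∉ touched u ∪ (⁅ u ⁆ ∪ ⁅ r ⁆)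
    z-choice = outside _ ∣touched∪ends∣<n

    z : Fin n
    z = proj₁ z-choice

    z∉touched : z ∉ touched u
    z∉touched z∈ = proj₂ z-choice (SubsetP.x∈p∪q⁺ (inj₁ z∈))

    z≢u : ¬ z ≡ u
    z≢u z≡u = proj₂ z-choice (SubsetP.x∈p∪q⁺ (inj₂ (SubsetP.x∈p∪q⁺ (inj₁ (subst (_∈ ⁅ u ⁆) (sym z≡u) (SubsetP.x∈⁅x⁆ u))))))

    z≢r : ¬ z ≡ r
    z≢r z≡r = proj₂ z-choice (SubsetP.x∈p∪q⁺ (inj₂ (SubsetP.x∈p∪q⁺ (inj₂ (subst (_∈ ⁅ r ⁆) (sym z≡r) (SubsetP.x∈⁅x⁆ r))))))

    u∉touched : u ∉ touched u
    u∉touched = end-∉-touched u u u∉rows (inj₁ refl)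

    r∉touched : r ∉ touched u
    r∉touched = end-∉-touched u r r∉rows (inj₂ refl)

    ∉∪⁅⁆ : ∀ {x : Fin n} {p y} → x ∉ p → ¬ x ≡ y → x ∉ p ∪ ⁅ y ⁆
    ∉∪⁅⁆ {x} {p} {y} x∉p x≢y x∈ with SubsetP.x∈p∪q⁻ p ⁅ y ⁆ x∈
    ... | inj₁ x∈p = x∉p x∈p
    ... | inj₂ x∈y = x≢y (SubsetP.x∈⁅y⁆⇒x≡y y x∈y)

    first-leg : PathAvoiding G (touched u ∪ ⁅ r ⁆) u z
    first-leg = proj₂ connected _ (∣touched∪⁅x⁆∣≤K r) u z (∉∪⁅⁆ u∉touched u≢r) (∉∪⁅⁆ z∉touched z≢r)

    second-leg : PathAvoiding G (touched u ∪ ⁅ u ⁆) z r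
    second-leg = proj₂ connected _ (∣touched∪⁅x⁆∣≤K u) z r (∉∪⁅⁆ z∉touched z≢u) (∉∪⁅⁆ r∉touched (≢-sym u≢r))

    detour-flow : Fin n → Fin n → ℤ
    detour-flow x y = path-flow first-leg x y + path-flow second-leg x y

    detour-antisym : ∀ x y → detour-flow y x ≡ - detour-flow x y
    detour-antisym x y = trans (cong₂ _+_ (path-flow-antisym first-leg x y) (path-flow-antisym second-leg x y))
      (sym (ℤP.neg-distrib-+ (path-flow first-leg x y) _))

    detour-off : ∀ x y → adj G x y ≡ false → detour-flow x y ≡ + 0
    detour-off x y not-adj = cong₂ _+_ (path-flow-off first-leg x y not-adj) (path-flow-off second-leg x y not-adj)

    detour-out : ∀ x → ∑ (detour-flow x) ≡ δ u x (+ 1) - δ r x (+ 1)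
    detour-out x = trans (∑-distrib-+ (path-flow first-leg x) (path-flow second-leg x))
      (trans (cong₂ _+_ (path-flow-out first-leg x) (path-flow-out second-leg x)) (telescope (δ u x (+ 1)) (δ z x (+ 1)) (δ r x (+ 1))))
      where telescope : ∀ s t w → (s - t) + (t - w) ≡ s - w
            telescope = solve-∀

    first-leg-touched : ∀ x → x ∈ touched u → ∀ y → path-flow first-leg x y ≡ + 0
    first-leg-touched x x∈ y = path-flow-row first-leg x (SubsetP.x∈p∪q⁺ (inj₁ x∈)) (λ u≡x → u∉touched (subst (_∈ touched u) (sym u≡x) x∈)) y

    second-leg-touched : ∀ x → x ∈ touched u → ∀ y → path-flow second-leg x y ≡ + 0
    second-leg-touched x x∈ y = path-flow-row second-leg x (SubsetP.x∈p∪q⁺ (inj₁ x∈)) (λ z≡x → z∉touched (subst (_∈ touched u) (sym z≡x) x∈)) y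

    detour-at-rows : ∀ v → v ∈ row-vertices → ∀ y → detour-flow v y ≡ + 0
    detour-at-rows v v∈ y with ∈-row-vertices⁻ v v∈
    ... | i , δ , csᵢ≡ = cong₂ _+_ (first-leg-touched v v∈touched y) (second-leg-touched v v∈touched y)
      where v∈touched : v ∈ touched u
            v∈touched = ∈-⋃ (λ j → touched-by u (cs j)) i (subst (λ C → v ∈ touched-by u C) (sym csᵢ≡) (SubsetP.x∈⁅x⁆ v))

    detour-at-edges : ∀ i v w t → cs i ≡ on-edge v w t → detour-flow v w ≡ + 0
    detour-at-edges i v w t csᵢ≡ = cong₂ _+_
      (vanishes-on-constrained-edge u (path-flow first-leg) (path-flow-antisym first-leg) (path-flow-off first-leg) first-leg-touched
        (inj₁ (path-flow-row first-leg r (SubsetP.x∈p∪q⁺ (inj₂ (SubsetP.x∈⁅x⁆ r))) u≢r)) v w where-touched)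
      (vanishes-on-constrained-edge u (path-flow second-leg) (path-flow-antisym second-leg) (path-flow-off second-leg) second-leg-touched
        (inj₂ (path-flow-row second-leg u (SubsetP.x∈p∪q⁺ (inj₂ (SubsetP.x∈⁅x⁆ u))) z≢u)) v w where-touched)
      where
      to-touched : ∀ x → x ∈ touched-by u (on-edge v w t) → x ∈ touched u
      to-touched x x∈ = ∈-⋃ (λ j → touched-by u (cs j)) i (subst (λ C → x ∈ touched-by u C) (sym csᵢ≡) x∈)
      where-touched : (v ∈ touched u ⊎ w ∈ touched u) ⊎ ((v ≡ u ⊎ v ≡ r) × (w ≡ u ⊎ w ≡ r))
      where-touched with edge-touched u v w t
      ... | inj₁ v∈ = inj₁ (inj₁ (to-touched v v∈))
      ... | inj₂ (inj₁ w∈) = inj₁ (inj₂ (to-touched w w∈))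
      ... | inj₂ (inj₂ ends) = inj₂ ends

  record Correction (u : Fin n) : Set where
    field
      value : Fin n → Fin n → ℤ
      value-antisym : ∀ x y → value y x ≡ - value x y
      value-off : ∀ x y → adj G x y ≡ false → value x y ≡ + 0
      value-out : ∀ x → ∑ (value x) ≡ excess u * (δ u x (+ 1) - δ r x (+ 1))
      value-at-rows : ∀ v → v ∈ row-vertices → ∀ y → value v y ≡ + 0
      value-at-edges : ∀ i v w t → cs i ≡ on-edge v w t → value v w ≡ + 0
  open Correction

  no-correction : ∀ u → (∀ x → excess u * (δ u x (+ 1) - δ r x (+ 1)) ≡ + 0) → Correction u
  no-correction u nothing-to-move = record
    { value = λ _ _ → + 0 ; value-antisym = λ _ _ → refl ; value-off = λ _ _ _ → refl
    ; value-out = λ x → trans (∑-zero {n} _ (λ _ → refl)) (sym (nothing-to-move x))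
    ; value-at-rows = λ _ _ _ → refl ; value-at-edges = λ _ _ _ _ _ → refl }

  correction : ∀ u → Correction u
  correction u with u ∈? row-vertices | u ≟ᶠ r
  ... | yes u∈ | _ = no-correction u (λ x → trans (cong (_* (δ u x (+ 1) - δ r x (+ 1))) (excess-at-row u u∈)) (ℤP.*-zeroˡ (δ u x (+ 1) - δ r x (+ 1))))
  ... | no _ | yes refl = no-correction u (λ x → trans (cong (excess u *_) (ℤP.+-inverseʳ (δ u x (+ 1)))) (ℤP.*-zeroʳ (excess u)))
  ... | no u∉ | no u≢r = record
    { value = λ x y → excess u * detour-flow x y
    ; value-antisym = λ x y → trans (cong (excess u *_) (detour-antisym x y)) (sym (ℤP.neg-distribʳ-* (excess u) (detour-flow x y)))
    ; value-off = λ x y not-adj → scaled-zero (detour-off x y not-adj)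
    ; value-out = λ x → trans (sym (*-distribˡ-sum (excess u) (detour-flow x))) (cong (excess u *_) (detour-out x))
    ; value-at-rows = λ v v∈ y → scaled-zero (detour-at-rows v v∈ y)
    ; value-at-edges = λ i v w t csᵢ≡ → scaled-zero (detour-at-edges i v w t csᵢ≡) }
    where
    open Detour u u∉ u≢r
    scaled-zero : ∀ {t} → t ≡ + 0 → excess u * t ≡ + 0
    scaled-zero t≡0 = trans (cong (excess u *_) t≡0) (ℤP.*-zeroʳ (excess u))

  total-correction : Fin n → Fin n → ℤ
  total-correction x y = ∑ (λ u → value (correction u) x y)

  repaired : Fin n → Fin n → ℤ
  repaired x y = base x y - total-correction x y

  repaired-antisym : ∀ x y → repaired y x ≡ - repaired x y
  repaired-antisym x y =
    trans (cong₂ _-_ (base-antisym x y) (trans (sum-cong-≗ (λ u → value-antisym (correction u) x y)) (∑-neg (λ u → value (correction u) x y))))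
          (neg-sub (base x y) (total-correction x y))
    where neg-sub : ∀ a b → - a - - b ≡ - (a - b)
          neg-sub = solve-∀

  repaired-off : ∀ x y → adj G x y ≡ false → repaired x y ≡ + 0
  repaired-off x y not-adj = cong₂ _-_ (base-off x y not-adj) (∑-zero _ (λ u → value-off (correction u) x y not-adj))

  ∑-*δ : ∀ (g : Fin n → ℤ) x → ∑ (λ u → g u * δ u x (+ 1)) ≡ g x
  ∑-*δ g x = trans (sum-cong-≗ pointwise) (∑-δ x (g x))
    where
    pointwise : ∀ u → g u * δ u x (+ 1) ≡ δ x u (g x)
    pointwise u with u ≟ᶠ x | x ≟ᶠ u
    ... | yes refl | yes _ = ℤP.*-identityʳ (g u)
    ... | yes refl | no x≢x = ⊥-elim (x≢x refl)
    ... | no u≢u | yes refl = ⊥-elim (u≢u refl)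
    ... | no _ | no _ = ℤP.*-zeroʳ (g u)

  repaired-out : ∀ x → ∑ (repaired x) ≡ base-out x - excess x + ∑ excess * δ r x (+ 1)
  repaired-out x = begin
      ∑ (repaired x)                                              ≡⟨ ∑-distrib-+ (base x) (λ y → - total-correction x y) ⟩
      base-out x + ∑ (λ y → - total-correction x y)               ≡⟨ cong (λ t → base-out x + t) (∑-neg (total-correction x)) ⟩
      base-out x - ∑ (total-correction x)                         ≡⟨ cong (λ t → base-out x - t) (sym (∑-comm (λ u y → value (correction u) x y))) ⟩
      base-out x - ∑ (λ u → ∑ (value (correction u) x))           ≡⟨ cong (λ t → base-out x - t) (sum-cong-≗ (λ u → value-out (correction u) x)) ⟩
      base-out x - ∑ (λ u → excess u * (δ u x (+ 1) - δ r x (+ 1))) ≡⟨ cong (λ t → base-out x - t) moved ⟩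
      base-out x - (excess x - δ r x (+ 1) * ∑ excess)            ≡⟨ rearrange (base-out x) (excess x) (δ r x (+ 1)) (∑ excess) ⟩
      base-out x - excess x + ∑ excess * δ r x (+ 1)              ∎
    where
    open ≡-Reasoning
    rearrange : ∀ a b c s → a - (b - c * s) ≡ a - b + s * c
    rearrange = solve-∀
    moved : ∑ (λ u → excess u * (δ u x (+ 1) - δ r x (+ 1))) ≡ excess x - δ r x (+ 1) * ∑ excess
    moved = begin
      ∑ (λ u → excess u * (δ u x (+ 1) - δ r x (+ 1)))                     ≡⟨ sum-cong-≗ (λ u → ℤP.*-distribˡ-+ (excess u) (δ u x (+ 1)) (- δ r x (+ 1))) ⟩
      ∑ (λ u → excess u * δ u x (+ 1) + excess u * - δ r x (+ 1))           ≡⟨ ∑-distrib-+ (λ u → excess u * δ u x (+ 1)) (λ u → excess u * - δ r x (+ 1)) ⟩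
      ∑ (λ u → excess u * δ u x (+ 1)) + ∑ (λ u → excess u * - δ r x (+ 1)) ≡⟨ cong₂ _+_ (∑-*δ excess x) (sum-cong-≗ (λ u → ℤP.*-comm (excess u) (- δ r x (+ 1)))) ⟩
      excess x + ∑ (λ u → - δ r x (+ 1) * excess u)                         ≡⟨ cong (λ t → excess x + t) (sym (*-distribˡ-sum (- δ r x (+ 1)) excess)) ⟩
      excess x + - δ r x (+ 1) * ∑ excess                                    ≡⟨ cong (λ t → excess x + t) (sym (ℤP.neg-distribˡ-* (δ r x (+ 1)) (∑ excess))) ⟩
      excess x - δ r x (+ 1) * ∑ excess                                      ∎

  repaired-balanced : ∀ x → ∑ (repaired x) ≈ + 0
  repaired-balanced x with x ∈? row-vertices
  ... | yes x∈ = begin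
      ∑ (repaired x)                                  ≡⟨ repaired-out x ⟩
      base-out x - excess x + ∑ excess * δ r x (+ 1)  ≈⟨ ≈-+ (≈-+ (base-balanced-at-rows x x∈) (≈-reflexive (cong -_ (excess-at-row x x∈)))) (≈-reflexive r-term) ⟩
      + 0 - + 0 + + 0                                 ≡⟨⟩
      + 0                                             ∎
    where
    open ≈-Reasoning
    r-term : ∑ excess * δ r x (+ 1) ≡ + 0
    r-term = trans (cong (∑ excess *_) (δ-other r x (+ 1) (λ r≡x → r∉rows (subst (_∈ row-vertices) (sym r≡x) x∈)))) (ℤP.*-zeroʳ (∑ excess))
  ... | no x∉ = begin
      ∑ (repaired x)                                  ≡⟨ repaired-out x ⟩
      base-out x - excess x + ∑ excess * δ r x (+ 1)  ≡⟨ cong (λ t → base-out x - t + ∑ excess * δ r x (+ 1)) (excess-off-row x x∉) ⟩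
      base-out x - base-out x + ∑ excess * δ r x (+ 1) ≡⟨ cancel (base-out x) (∑ excess * δ r x (+ 1)) ⟩
      ∑ excess * δ r x (+ 1)                          ≡⟨ ℤP.*-comm (∑ excess) _ ⟩
      δ r x (+ 1) * ∑ excess                          ≈⟨ ≈-*ˡ (δ r x (+ 1)) total-excess ⟩
      δ r x (+ 1) * + 0                               ≡⟨ ℤP.*-zeroʳ (δ r x (+ 1)) ⟩
      + 0                                             ∎
    where
    open ≈-Reasoning
    cancel : ∀ a b → a - a + b ≡ b
    cancel = solve-∀

  extended-flow : Flow
  extended-flow = record { c = repaired ; antisym = repaired-antisym ; off = repaired-off ; balanced = repaired-balanced }

  correction-at-requirement : ∀ i x y s → Requires (cs i) x y s → ∀ u → value (correction u) x y ≡ + 0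
  correction-at-requirement i x y s req u = by-constraint (cs i) refl req
    where
    C = correction u
    by-constraint : ∀ C' → cs i ≡ C' → Requires C' x y s → value C x y ≡ + 0
    by-constraint .(on-edge x y _) csᵢ≡ edge-forward = value-at-edges C i x y _ csᵢ≡
    by-constraint .(on-edge y x _) csᵢ≡ edge-backward = trans (value-antisym C y x) (cong -_ (value-at-edges C i y x _ csᵢ≡))
    by-constraint .(on-row x _) csᵢ≡ row-forward = value-at-rows C x (∈-row-vertices i x _ csᵢ≡) y
    by-constraint .(on-row y _) csᵢ≡ row-backward =
      zero-row-antisym (value C) (value-antisym C) y (value-at-rows C y (∈-row-vertices i y _ csᵢ≡)) x

  extended-flow-meets : ∀ i x y s → T (adj G x y) → Requires (cs i) x y s → c extended-flow x y ≈ s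
  extended-flow-meets i x y s xy-edge req =
    ≈-trans (≈-reflexive (trans (cong (λ t → base x y - t) (∑-zero _ (correction-at-requirement i x y s req))) (ℤP.+-identityʳ _)))
            (base-meets i x y s xy-edge req)

has-neighbour : ∀ {n} (G : Graph n) (K : ℕ) → KConnected G K → 1 < n → ∀ v → Σ (Fin n) λ w → T (adj G v w)
has-neighbour {n} G K connected 1<n v with outside ⁅ v ⁆ (subst (_< n) (sym (SubsetP.∣⁅x⁆∣≡1 v)) 1<n)
... | u , u∉⁅v⁆ with proj₂ connected ∅ (subst (_≤ K) (sym (SubsetP.∣⊥∣≡0 n)) z≤n) v u SubsetP.∉⊥ SubsetP.∉⊥
... | here = ⊥-elim (u∉⁅v⁆ (SubsetP.x∈⁅x⁆ v))
... | step v→w _ _ = _ , v→w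

equivalent⇒automorphic : (q : ℕ) .{{_ : NonZero q}} {n : ℕ} (G : Graph n) (d : Fin n → Fin q) (K : ℕ) → KConnected G K →
  (k m : ℕ) → suc (suc m) ≤ k → suc (suc m) ≤ K → (a b : Fin m → Carrier (CFI q G d)) → TupleEquiv k (CFI q G d) m a b →
  Σ (Carrier (CFI q G d) ↔ Carrier (CFI q G d)) λ π → IsAutomorphism (CFI q G d) π × (∀ i → Inverse.to π (a i) ≡ b i)
equivalent⇒automorphic q G d K connected k m m+2≤k m+2≤K a b equiv =
  flow-automorphism F , flow-automorphism-is-automorphism F ,
  λ i → flow-map-corresponds F (same-class i) (extended-flow-meets i)
  where
  open CFIBasics q G d
  open Correspondence q G d
  1<n : 1 < _
  1<n = ℕP.≤-trans (s≤s (s≤s z≤n)) (ℕP.≤-trans m+2≤K (ℕP.<⇒≤ (proj₁ connected)))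
  open Extraction q G d k m m+2≤k a b equiv (has-neighbour G K connected 1<n)
  open FlowExtension q G d K connected m m+2≤K (λ i → constraint (same-class i))
    (λ i → row-constraint-admissible (same-class i)) consistent
  F = extended-flow

mainTheorem8 : (q : ℕ) .{{_ : NonZero q}} → Prime q →
    (ℓ : ℕ) → 1 ≤ ℓ →
    {n : ℕ} (G : Graph n) → ConGreaterThan G (ℓ ℕ.+ 2) →
    (d : Fin n → Fin q) →
    (m : ℕ) → m ≤ ℓ →
    (a b : Fin m → Carrier (CFI q G d)) →
    (TupleEquiv (ℓ ℕ.+ 2) (CFI q G d) m a b →
       Σ (Carrier (CFI q G d) ↔ Carrier (CFI q G d)) (λ π →
         IsAutomorphism (CFI q G d) π × (∀ i → Inverse.to π (a i) ≡ b i)))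
    × (Σ (Carrier (CFI q G d) ↔ Carrier (CFI q G d)) (λ π →
         IsAutomorphism (CFI q G d) π × (∀ i → Inverse.to π (a i) ≡ b i)) →
       TupleEquiv (ℓ ℕ.+ 2) (CFI q G d) m a b)
mainTheorem8 q _ ℓ _ G (K , _ , ℓ+2<K , connected) d m m≤ℓ a b =
  equivalent⇒automorphic q G d K connected (ℓ ℕ.+ 2) m m+2≤ℓ+2 (ℕP.≤-trans m+2≤ℓ+2 (ℕP.<⇒≤ ℓ+2<K)) a b ,
  λ { (π , aut , a↦b) → Invariance.automorphic⇒equivalent (CFI q G d) π aut (ℓ ℕ.+ 2) m a b a↦b }
  where
  m+2≤ℓ+2 : suc (suc m) ≤ ℓ ℕ.+ 2
  m+2≤ℓ+2 = subst (_≤ ℓ ℕ.+ 2) (ℕP.+-comm m 2) (ℕP.+-monoˡ-≤ 2 m≤ℓ)
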